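{- Let $S$ be a Seidel matrix of order $n$ and let $T=S[j]$ for some $j\in\{1,\dots,n\}$. Suppose $S$ has minimal polynomial $m_S(x)=\sum_{i=0}^d a_ix^{d-i}$. Then $$\chi_T(x)=\frac{\chi_S(x)}{m_S(x)}\sum_{i=0}^{d-1}b_ix^{d-1-i},$$ where $b_0=1$, $b_1=a_1$, $b_2=a_2+n-1$, and $b_i\in\mathbb Z$ for $i\in\{3,\dots,d-1\}$.
   Context: A Seidel matrix is a symmetric matrix with all diagonal entries $0$ and all off-diagonal entries $\pm1$. $\chi_M(x)=\det(xI-M)$. For a matrix $M$, $M[j]$ denotes the principal submatrix obtained by deleting the $j$-th row and column. -}

module Defs where

open import Data.Nat using (ℕ; zero; suc)
open import Data.Integer using (ℤ; +_; -_; 0ℤ; 1ℤ; -1ℤ) renaming (_+_ to _+ℤ_; _*_ to _*ℤ_)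
open import Data.Fin using (Fin; zero; suc; punchIn; opposite; _≟_)
open import Data.List using (List; []; _∷_; map; allFin)
open import Data.Sum using (_⊎_)
open import Relation.Binary.PropositionalEquality using (_≡_; _≢_)
open import Relation.Nullary using (yes; no)

sumFin : {A : Set} → (A → A → A) → A → (n : ℕ) → (Fin n → A) → A
sumFin _⊕_ e zero    f = e
sumFin _⊕_ e (suc n) f = f zero ⊕ sumFin _⊕_ e n (λ i → f (suc i))

-- Integer polynomials: coefficient lists in ASCENDING degree order
-- (the k-th entry is the coefficient of x^k).

Poly : Set
Poly = List ℤ

coeff : Poly → ℕ → ℤ
coeff []       _       = 0ℤ
coeff (c ∷ p)  zero    = c
coeff (c ∷ p)  (suc k) = coeff p k

-- equality of polynomials (coefficientwise; trailing zeros irrelevant)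
_≈P_ : Poly → Poly → Set
p ≈P q = ∀ k → coeff p k ≡ coeff q k

infix 4 _≈P_
infixl 6 _+P_
infixl 7 _*P_

_+P_ : Poly → Poly → Poly
[]      +P q       = q
(a ∷ p) +P []      = a ∷ p
(a ∷ p) +P (b ∷ q) = (a +ℤ b) ∷ (p +P q)

scaleP : ℤ → Poly → Poly
scaleP c = map (c *ℤ_)

_*P_ : Poly → Poly → Poly
[]      *P q = []
(a ∷ p) *P q = scaleP a q +P (0ℤ ∷ (p *P q))

constP : ℤ → Poly
constP c = c ∷ []

X : Poly
X = 0ℤ ∷ 1ℤ ∷ []

negP : Poly → Poly
negP = map -_

Mat : Set → ℕ → Set
Mat A n = Fin n → Fin n → A

principalSub : {A : Set} {n : ℕ} → Fin (suc n) → Mat A (suc n) → Mat A n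
principalSub j M a b = M (punchIn j a) (punchIn j b)

IsSeidel : {n : ℕ} → Mat ℤ n → Set
IsSeidel {n} S =
  (∀ i → S i i ≡ 0ℤ) ×' ((∀ i j → S i j ≡ S j i) ×'
  (∀ i j → i ≢ j → (S i j ≡ 1ℤ ⊎ S i j ≡ -1ℤ)))
  where open import Data.Product renaming (_×_ to _×'_)

signP : ℕ → Poly
signP zero          = constP 1ℤ
signP (suc zero)    = constP -1ℤ
signP (suc (suc k)) = signP k

detP : (n : ℕ) → Mat Poly n → Poly
detP zero    M = constP 1ℤ
detP (suc n) M =
  sumFin _+P_ [] (suc n)
    (λ k → signP (Data.Fin.toℕ k) *P M zero k *P
           detP n (λ a b → M (suc a) (punchIn k b)))

charPoly : {n : ℕ} → Mat ℤ n → Poly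
charPoly {n} M = detP n (λ i j → entry i j)
  where
  entry : Fin n → Fin n → Poly
  entry i j with i ≟ j
  ... | yes _ = X +P constP (- M i j)
  ... | no  _ = constP (- M i j)

identityM : {n : ℕ} → Mat ℤ n
identityM i j with i ≟ j
... | yes _ = 1ℤ
... | no  _ = 0ℤ

_*M_ : {n : ℕ} → Mat ℤ n → Mat ℤ n → Mat ℤ n
_*M_ {n} A B i j = sumFin _+ℤ_ 0ℤ n (λ k → A i k *ℤ B k j)

evalM : {n : ℕ} → Poly → Mat ℤ n → Mat ℤ n
evalM []      M i j = 0ℤ
evalM (c ∷ p) M i j = c *ℤ identityM i j +ℤ (M *M evalM p M) i j

Annihilates : {n : ℕ} → Poly → Mat ℤ n → Set
Annihilates p M = ∀ i j → evalM p M i j ≡ 0ℤ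

-- Polynomials given by coefficient vectors in DESCENDING order,
-- as in the paper: fromDesc d a = Σ_{i=0}^{d} a_i x^{d-i}.

fromDesc : (d : ℕ) → (Fin (suc d) → ℤ) → Poly
fromDesc d a = map (λ k → a (opposite k)) (allFin (suc d))

fromDesc' : (d : ℕ) → (Fin d → ℤ) → Poly
fromDesc' d b = map (λ k → b (opposite k)) (allFin d)

IsMinPoly : {n : ℕ} → Mat ℤ n → (d : ℕ) → (Fin (suc d) → ℤ) → Set
IsMinPoly M d a =
  (a zero ≡ 1ℤ) ×' (Annihilates (fromDesc d a) M ×'
  (∀ (p : Poly) → Annihilates p M →
     (∀ k → d Data.Nat.≤ k → coeff p k ≡ 0ℤ) → ∀ k → coeff p k ≡ 0ℤ))
  where open import Data.Product renaming (_×_ to _×'_)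

module Submission where

-- Write A = xI − S over ℤ[x] and let Q_p = (p(x)I − p(S))/(x − S), the polynomial matrix given by
-- Horner's scheme, so that A·Q_p = p(x)I − p(S). If A·D is a constant matrix C, comparing
-- coefficients gives D_t = S·D_{t+1} for the coefficient matrices of D, so D = 0 and C = 0.
-- Dividing χ_S = q·m_S + r and applying this to D = adj(A) − q·Q_m − Q_r gives r(S) = 0, hence
-- r = 0 by minimality, and adj(A) = q·Q_m. Then χ_T = adj(A)_jj = q·(Q_m)_jj, and the top
-- coefficients of (Q_m)_jj are the diagonal entries of I, a₁I + S and a₂I + a₁S + S², which
-- for a Seidel matrix are 1, a₁ and a₂ + n − 1.

open import Level using (0ℓ)
open import Algebra using (CommutativeRing)
import Algebra.Properties.Ring as RingProperties
open import Data.Nat as ℕ using (ℕ; zero; suc; _≤_; _<_; s≤s; z≤n; _∸_)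
import Data.Nat.Properties as ℕₚ
open import Data.Fin as Fin using (Fin; zero; suc; punchIn; punchOut; toℕ; inject₁; opposite; fromℕ<; _≟_)
import Data.Fin.Properties as Finₚ
open import Data.List using (List; []; _∷_; drop; length; tabulate)
import Data.List.Properties as Listₚ
open import Data.Product using (_×_; _,_; proj₁; proj₂; ∃-syntax)
open import Data.Sum using (_⊎_; inj₁; inj₂)
open import Data.Empty using (⊥-elim)
open import Function using (_∘_)
open import Relation.Nullary using (¬_; yes; no)
import Relation.Binary.Reasoning.Setoid as SetoidReasoning
open import Relation.Binary.PropositionalEquality as ≡ using (_≡_; _≢_; cong; cong₂)

module RingIdentities {c ℓ} (R : CommutativeRing c ℓ) where

  open CommutativeRing R
  open import Algebra.Properties.Ring ring
    using (-‿+-comm; -‿involutive; -‿distribˡ-*; -‿distribʳ-*; ⁻¹-anti-homo‿-; xyx⁻¹≈y; x[y-z]≈xy-xz)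
  open import Algebra.Properties.CommutativeSemigroup +-commutativeSemigroup using (interchange)
  open import Algebra.Properties.CommutativeSemigroup *-commutativeSemigroup using (x∙yz≈y∙xz)
  open import Relation.Binary.Reasoning.Setoid setoid

  x+[y-x]≈y : ∀ x y → x + (y - x) ≈ y
  x+[y-x]≈y x y = trans (sym (+-assoc x y (- x))) (xyx⁻¹≈y x y)

  [x-y]+[y-z]≈x-z : ∀ x y z → (x - y) + (y - z) ≈ x - z
  [x-y]+[y-z]≈x-z x y z = begin
    (x - y) + (y - z)      ≈⟨ +-assoc x (- y) (y - z) ⟩
    x + (- y + (y - z))    ≈⟨ +-congˡ (+-congˡ (⁻¹-anti-homo‿- z y)) ⟨
    x + (- y + - (z - y))  ≈⟨ +-congˡ (-‿+-comm y (z - y)) ⟩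
    x - (y + (z - y))      ≈⟨ +-congˡ (-‿cong (x+[y-x]≈y y z)) ⟩
    x - z                  ∎

  x-y≈[z+x]-[z+y] : ∀ x y z → x - y ≈ (z + x) - (z + y)
  x-y≈[z+x]-[z+y] x y z = begin
    x - y                  ≈⟨ +-identityˡ (x - y) ⟨
    0# + (x - y)           ≈⟨ +-congʳ (-‿inverseʳ z) ⟨
    (z - z) + (x - y)      ≈⟨ interchange z (- z) x (- y) ⟩
    (z + x) + (- z - y)    ≈⟨ +-congˡ (-‿+-comm z y) ⟩
    (z + x) - (z + y)      ∎

  [x+y]+[z-x]≈y+z : ∀ x y z → (x + y) + (z - x) ≈ y + z
  [x+y]+[z-x]≈y+z x y z = begin
    (x + y) + (z - x)      ≈⟨ +-congʳ (+-comm x y) ⟩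
    (y + x) + (z - x)      ≈⟨ +-assoc y x (z - x) ⟩
    y + (x + (z - x))      ≈⟨ +-congˡ (x+[y-x]≈y x z) ⟩
    y + z                  ∎

  x*[y-z]+[x*z-w]≈x*y-w : ∀ x y z w → x * (y - z) + (x * z - w) ≈ x * y - w
  x*[y-z]+[x*z-w]≈x*y-w x y z w =
    trans (+-congʳ (x[y-z]≈xy-xz x y z)) ([x-y]+[y-z]≈x-z (x * y) (x * z) w)

  x*[y*z+w]-[y*[x*z]+[x*w-v]]≈v : ∀ x y z w v → x * (y * z + w) - (y * (x * z) + (x * w - v)) ≈ v
  x*[y*z+w]-[y*[x*z]+[x*w-v]]≈v x y z w v = begin
    x * (y * z + w) - (y * (x * z) + (x * w - v))
      ≈⟨ +-congʳ (trans (distribˡ x (y * z) w) (+-congʳ (x∙yz≈y∙xz x y z))) ⟩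
    (y * (x * z) + x * w) - (y * (x * z) + (x * w - v))
      ≈⟨ x-y≈[z+x]-[z+y] (x * w) (x * w - v) (y * (x * z)) ⟨
    x * w - (x * w - v)
      ≈⟨ +-congˡ (⁻¹-anti-homo‿- (x * w) v) ⟩
    x * w + (v - x * w)
      ≈⟨ x+[y-x]≈y (x * w) v ⟩
    v ∎

  -x*-y≈x*y : ∀ x y → - x * - y ≈ x * y
  -x*-y≈x*y x y = begin
    - x * - y      ≈⟨ -‿distribˡ-* x (- y) ⟨
    - (x * - y)    ≈⟨ -‿cong (-‿distribʳ-* x y) ⟨
    - - (x * y)    ≈⟨ -‿involutive _ ⟩
    x * y          ∎

  -x*y*z≈-[x*y*z] : ∀ x y z → - x * y * z ≈ - (x * y * z)
  -x*y*z≈-[x*y*z] x y z = trans (*-congʳ (sym (-‿distribˡ-* x y))) (sym (-‿distribˡ-* (x * y) z))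

module Determinant {c ℓ} (R : CommutativeRing c ℓ) where

  open CommutativeRing R hiding (zero)
  open import Algebra.Properties.Ring ring
    using (-‿distribˡ-*; -‿distribʳ-*; -0#≈0#; -‿+-comm; ⁻¹-anti-homo‿-)
  open RingIdentities R using (-x*-y≈x*y; -x*y*z≈-[x*y*z])
  open import Algebra.Properties.CommutativeSemigroup *-commutativeSemigroup
    using (x∙yz≈y∙xz)
  open import Algebra.Properties.Semiring.Sum semiring public
    using (sum; sum-cong-≋; sum-replicate-zero; sum-remove; ∑-distrib-+; *-distribˡ-sum)
  open import Relation.Binary.Reasoning.Setoid setoid

  sum-zero : ∀ {n} {f : Fin n → Carrier} → (∀ i → f i ≈ 0#) → sum f ≈ 0#
  sum-zero {n} f≈0 = trans (sum-cong-≋ f≈0) (sum-replicate-zero n)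

  -‿distrib-sum : ∀ {n} (f : Fin n → Carrier) → - sum f ≈ sum (λ i → - f i)
  -‿distrib-sum {zero}  f = -0#≈0#
  -‿distrib-sum {suc n} f = trans (sym (-‿+-comm _ _)) (+-congˡ (-‿distrib-sum (f ∘ suc)))

  sum-single : ∀ {n} (f : Fin (suc n) → Carrier) k → (∀ i → i ≢ k → f i ≈ 0#) → sum f ≈ f k
  sum-single f k vanish = begin
    sum f                      ≈⟨ sum-remove {i = k} f ⟩
    f k + sum (f ∘ punchIn k)  ≈⟨ +-congˡ (sum-zero (λ i → vanish (punchIn k i) (Finₚ.punchInᵢ≢i k i))) ⟩
    f k + 0#                   ≈⟨ +-identityʳ _ ⟩
    f k                        ∎

  Matrix : ℕ → Set c
  Matrix n = Fin n → Fin n → Carrier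

  infixl 7 _⊗_
  _⊗_ : ∀ {n} → Matrix n → Matrix n → Matrix n
  (A ⊗ B) i k = sum (λ l → A i l * B l k)

  ⊗-distribˡ-+ : ∀ {n} (A B C : Matrix n) i k →
    (A ⊗ (λ a b → B a b + C a b)) i k ≈ (A ⊗ B) i k + (A ⊗ C) i k
  ⊗-distribˡ-+ A B C i k = trans
    (sum-cong-≋ (λ l → distribˡ (A i l) (B l k) (C l k)))
    (∑-distrib-+ (λ l → A i l * B l k) (λ l → A i l * C l k))

  ⊗-scaleʳ : ∀ {n} (A B : Matrix n) x i k → (A ⊗ (λ a b → x * B a b)) i k ≈ x * (A ⊗ B) i k
  ⊗-scaleʳ A B x i k = trans
    (sum-cong-≋ (λ l → x∙yz≈y∙xz (A i l) x (B l k)))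
    (sym (*-distribˡ-sum x (λ l → A i l * B l k)))

  ⊗-negʳ : ∀ {n} (A B : Matrix n) i k → (A ⊗ (λ a b → - B a b)) i k ≈ - (A ⊗ B) i k
  ⊗-negʳ A B i k = trans
    (sum-cong-≋ (λ l → sym (-‿distribʳ-* (A i l) (B l k))))
    (sym (-‿distrib-sum (λ l → A i l * B l k)))

  sign : ℕ → Carrier
  sign zero    = 1#
  sign (suc k) = - sign k

  sign*sign≈1 : ∀ k → sign k * sign k ≈ 1#
  sign*sign≈1 zero    = *-identityˡ 1#
  sign*sign≈1 (suc k) = trans (-x*-y≈x*y (sign k) (sign k)) (sign*sign≈1 k)

  minor₀ : ∀ {n} → Fin (suc n) → Matrix (suc n) → Matrix n
  minor₀ k M a b = M (suc a) (punchIn k b)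

  det : ∀ n → Matrix n → Carrier
  det zero    M = 1#
  det (suc n) M = sum (λ k → sign (toℕ k) * M zero k * det n (minor₀ k M))

  det-cong : ∀ n {M N : Matrix n} → (∀ i k → M i k ≈ N i k) → det n M ≈ det n N
  det-cong zero    M≈N = refl
  det-cong (suc n) {M} {N} M≈N = sum-cong-≋ {x = expansion M} {y = expansion N} λ k →
    *-cong (*-congˡ (M≈N zero k))
           (det-cong n {minor₀ k M} {minor₀ k N} (λ a b → M≈N (suc a) (punchIn k b)))
    where
    expansion : Matrix (suc n) → Fin (suc n) → Carrier
    expansion A k = sign (toℕ k) * A zero k * det n (minor₀ k A)

  -- Cofactors m assigns to an injective choice of m columns the determinant
  -- of the last m rows restricted to those columns.
  Cofactors : ℕ → Set c
  Cofactors m = (Fin m → Fin (suc (suc m))) → Carrier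

  Respects≗ : ∀ {m} → Cofactors m → Set ℓ
  Respects≗ E = ∀ {g h} → (∀ y → g y ≡ h y) → E g ≈ E h

  -- Laplace expansion along two rows a and b; the variants marked ⁺ use only the columns 1, 2, ….
  expand₂ : ∀ m (a b : Fin (suc (suc m)) → Carrier) → Cofactors m → Carrier
  expand₂ m a b E = sum λ c → sign (toℕ c) * a c *
    sum (λ l → sign (toℕ l) * b (punchIn c l) * E (punchIn c ∘ punchIn l))

  expand₁⁺ : ∀ m (b : Fin (suc (suc m)) → Carrier) → Cofactors m → Carrier
  expand₁⁺ m b E = sum λ l → sign (toℕ l) * b (suc l) * E (suc ∘ punchIn l)

  expand₂⁺ : ∀ m (a b : Fin (suc (suc m)) → Carrier) → Cofactors m → Carrier
  expand₂⁺ zero    a b E = 0#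
  expand₂⁺ (suc m) a b E = expand₂ m (a ∘ suc) (b ∘ suc) (E ∘ Fin.lift 1)

  Respects≗-lift : ∀ {m} {E : Cofactors (suc m)} → Respects≗ E → Respects≗ (E ∘ Fin.lift 1)
  Respects≗-lift E-resp g≗h = E-resp λ { zero → ≡.refl ; (suc y) → ≡.cong suc (g≗h y) }

  shiftedTerms≈expand₂⁺ : ∀ m a b {E : Cofactors m} → Respects≗ E →
    sum (λ c → - sign (toℕ c) * a (suc c) *
      sum (λ l → - sign (toℕ l) * b (suc (punchIn c l)) * E (punchIn (suc c) ∘ punchIn (suc l))))
    ≈ expand₂⁺ m a b E
  shiftedTerms≈expand₂⁺ zero    a b E-resp = sum-zero (λ c → zeroʳ (- sign (toℕ c) * a (suc c)))
  shiftedTerms≈expand₂⁺ (suc m) a b {E} E-resp = sum-cong-≋ λ c → begin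
    - sign (toℕ c) * a (suc c) * sum (λ l → - sign (toℕ l) * b' c l * E (g c l))
      ≈⟨ *-cong (sym (-‿distribˡ-* (sign (toℕ c)) (a (suc c)))) (sum-cong-≋ λ l →
           trans (-x*y*z≈-[x*y*z] (sign (toℕ l)) (b' c l) (E (g c l)))
                 (-‿cong (*-congˡ (E-resp (g≗lift c l))))) ⟩
    - (sign (toℕ c) * a (suc c)) * sum (λ l → - (sign (toℕ l) * b' c l * E (Fin.lift 1 (h c l))))
      ≈⟨ *-congˡ (-‿distrib-sum (λ l → sign (toℕ l) * b' c l * E (Fin.lift 1 (h c l)))) ⟨
    - (sign (toℕ c) * a (suc c)) * - sum (λ l → sign (toℕ l) * b' c l * E (Fin.lift 1 (h c l)))
      ≈⟨ -x*-y≈x*y _ _ ⟩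
    sign (toℕ c) * a (suc c) * sum (λ l → sign (toℕ l) * b' c l * E (Fin.lift 1 (h c l))) ∎
    where
    b' : Fin (suc (suc m)) → Fin (suc m) → Carrier
    b' c l = b (suc (punchIn c l))
    g : Fin (suc (suc m)) → Fin (suc m) → Fin (suc m) → Fin (suc (suc (suc m)))
    g c l = punchIn (suc c) ∘ punchIn (suc l)
    h : Fin (suc (suc m)) → Fin (suc m) → Fin m → Fin (suc (suc m))
    h c l = punchIn c ∘ punchIn l
    g≗lift : ∀ c l y → g c l y ≡ Fin.lift 1 (h c l) y
    g≗lift c l zero    = ≡.refl
    g≗lift c l (suc y) = ≡.refl

  -- Split off the terms in which one of the two rows uses column zero.
  expand₂-unfold : ∀ m a b {E : Cofactors m} → Respects≗ E →
    expand₂ m a b E ≈ (a zero * expand₁⁺ m b E - b zero * expand₁⁺ m a E) + expand₂⁺ m a b E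
  expand₂-unfold m a b {E} E-resp = begin
    expand₂ m a b E
      ≈⟨ +-cong (*-congʳ (*-identityˡ (a zero))) (sum-cong-≋ λ c → distribˡ (α c) (β c) (γ c)) ⟩
    a zero * expand₁⁺ m b E + sum (λ c → α c * β c + α c * γ c)
      ≈⟨ +-congˡ (∑-distrib-+ (λ c → α c * β c) (λ c → α c * γ c)) ⟩
    a zero * expand₁⁺ m b E + (sum (λ c → α c * β c) + sum (λ c → α c * γ c))
      ≈⟨ +-congˡ (+-cong b-in-column-zero (shiftedTerms≈expand₂⁺ m a b E-resp)) ⟩
    a zero * expand₁⁺ m b E + (- (b zero * expand₁⁺ m a E) + expand₂⁺ m a b E)
      ≈⟨ +-assoc _ _ _ ⟨
    (a zero * expand₁⁺ m b E - b zero * expand₁⁺ m a E) + expand₂⁺ m a b E ∎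
    where
    α : Fin (suc m) → Carrier
    α c = - sign (toℕ c) * a (suc c)
    β : Fin (suc m) → Carrier
    β c = 1# * b zero * E (suc ∘ punchIn c)
    γ : Fin (suc m) → Carrier
    γ c = sum λ l → - sign (toℕ l) * b (suc (punchIn c l)) * E (punchIn (suc c) ∘ punchIn (suc l))
    α*β : ∀ c → α c * β c ≈ - (b zero * (sign (toℕ c) * a (suc c) * E (suc ∘ punchIn c)))
    α*β c = begin
      α c * β c
        ≈⟨ *-cong (sym (-‿distribˡ-* _ _)) (*-congʳ (*-identityˡ (b zero))) ⟩
      - (sign (toℕ c) * a (suc c)) * (b zero * E (suc ∘ punchIn c))
        ≈⟨ -‿distribˡ-* _ _ ⟨
      - (sign (toℕ c) * a (suc c) * (b zero * E (suc ∘ punchIn c)))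
        ≈⟨ -‿cong (x∙yz≈y∙xz _ _ _) ⟩
      - (b zero * (sign (toℕ c) * a (suc c) * E (suc ∘ punchIn c))) ∎
    b-in-column-zero : sum (λ c → α c * β c) ≈ - (b zero * expand₁⁺ m a E)
    b-in-column-zero = begin
      sum (λ c → α c * β c)
        ≈⟨ sum-cong-≋ α*β ⟩
      sum (λ c → - (b zero * (sign (toℕ c) * a (suc c) * E (suc ∘ punchIn c))))
        ≈⟨ -‿distrib-sum (λ c → b zero * (sign (toℕ c) * a (suc c) * E (suc ∘ punchIn c))) ⟨
      - sum (λ c → b zero * (sign (toℕ c) * a (suc c) * E (suc ∘ punchIn c)))
        ≈⟨ -‿cong (*-distribˡ-sum (b zero) (λ c → sign (toℕ c) * a (suc c) * E (suc ∘ punchIn c))) ⟨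
      - (b zero * expand₁⁺ m a E) ∎

  mutual
    expand₂-antisym : ∀ m a b {E : Cofactors m} → Respects≗ E → expand₂ m a b E ≈ - expand₂ m b a E
    expand₂-antisym m a b {E} E-resp = begin
      expand₂ m a b E
        ≈⟨ expand₂-unfold m a b E-resp ⟩
      (x - y) + expand₂⁺ m a b E
        ≈⟨ +-cong (sym (⁻¹-anti-homo‿- y x)) (expand₂⁺-antisym m a b E-resp) ⟩
      - (y - x) + - expand₂⁺ m b a E
        ≈⟨ -‿+-comm _ _ ⟩
      - ((y - x) + expand₂⁺ m b a E)
        ≈⟨ -‿cong (expand₂-unfold m b a E-resp) ⟨
      - expand₂ m b a E ∎
      where
      x = a zero * expand₁⁺ m b E
      y = b zero * expand₁⁺ m a E

    expand₂⁺-antisym : ∀ m a b {E : Cofactors m} → Respects≗ E → expand₂⁺ m a b E ≈ - expand₂⁺ m b a E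
    expand₂⁺-antisym zero    a b E-resp = sym -0#≈0#
    expand₂⁺-antisym (suc m) a b E-resp = expand₂-antisym m (a ∘ suc) (b ∘ suc) (Respects≗-lift E-resp)

  mutual
    expand₂-self : ∀ m a {E : Cofactors m} → Respects≗ E → expand₂ m a a E ≈ 0#
    expand₂-self m a {E} E-resp = begin
      expand₂ m a a E                              ≈⟨ expand₂-unfold m a a E-resp ⟩
      (x - x) + expand₂⁺ m a a E                   ≈⟨ +-cong (-‿inverseʳ x) (expand₂⁺-self m a E-resp) ⟩
      0# + 0#                                      ≈⟨ +-identityʳ 0# ⟩
      0#                                           ∎
      where x = a zero * expand₁⁺ m a E

    expand₂⁺-self : ∀ m a {E : Cofactors m} → Respects≗ E → expand₂⁺ m a a E ≈ 0#
    expand₂⁺-self zero    a E-resp = refl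
    expand₂⁺-self (suc m) a E-resp = expand₂-self m (a ∘ suc) (Respects≗-lift E-resp)

  lowerCofactors : ∀ {m} → Matrix (suc (suc m)) → Cofactors m
  lowerCofactors {m} M g = det m (λ x y → M (suc (suc x)) (g y))

  lowerCofactors-resp : ∀ {m} (M : Matrix (suc (suc m))) → Respects≗ (lowerCofactors M)
  lowerCofactors-resp M g≗h = det-cong _ (λ x y → reflexive (≡.cong (M (suc (suc x))) (g≗h y)))

  swap₀₁ : ∀ {n} → Fin (suc (suc n)) → Fin (suc (suc n))
  swap₀₁ zero          = suc zero
  swap₀₁ (suc zero)    = zero
  swap₀₁ (suc (suc x)) = suc (suc x)

  det-swap₀₁ : ∀ {n} (M : Matrix (suc (suc n))) → det (suc (suc n)) M ≈ - det (suc (suc n)) (M ∘ swap₀₁)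
  det-swap₀₁ M = expand₂-antisym _ (M zero) (M (suc zero)) (lowerCofactors-resp M)

  infixr 5 _▹_
  _▹_ : ∀ {m n} → (Fin n → Carrier) → (Fin m → Fin n → Carrier) → Fin (suc m) → Fin n → Carrier
  (r ▹ N) zero    = r
  (r ▹ N) (suc a) = N a

  deleteRow : ∀ {m n} → Fin (suc m) → (Fin (suc m) → Fin n → Carrier) → Fin m → Fin n → Carrier
  deleteRow k M a = M (punchIn k a)

  det-scaleMinors : ∀ {n} {M N : Matrix (suc n)} x → (∀ c → M zero c ≈ N zero c) →
    (∀ c → det n (minor₀ c M) ≈ x * det n (minor₀ c N)) → det (suc n) M ≈ x * det (suc n) N
  det-scaleMinors {n} {M} {N} x top≈ minors≈ = trans
    (sum-cong-≋ λ c → trans (*-cong (*-congˡ (top≈ c)) (minors≈ c))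
                            (x∙yz≈y∙xz (sign (toℕ c) * N zero c) x (det n (minor₀ c N))))
    (sym (*-distribˡ-sum x (λ c → sign (toℕ c) * N zero c * det n (minor₀ c N))))

  -- After swapping the first two rows, each minor along the top row is a minor of M with its
  -- row k moved to the top.
  det-rowToTop : ∀ n (M : Matrix (suc n)) k → det (suc n) (M k ▹ deleteRow k M) ≈ sign (toℕ k) * det (suc n) M
  det-rowToTop n M zero = trans
    (det-cong (suc n) {M zero ▹ deleteRow zero M} {M} λ { zero b → refl ; (suc a) b → refl })
    (sym (*-identityˡ (det (suc n) M)))
  det-rowToTop (suc n) M (suc k) = begin
    det (suc (suc n)) (M (suc k) ▹ deleteRow (suc k) M)
      ≈⟨ det-swap₀₁ (M (suc k) ▹ deleteRow (suc k) M) ⟩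
    - det (suc (suc n)) ((M (suc k) ▹ deleteRow (suc k) M) ∘ swap₀₁)
      ≈⟨ -‿cong (det-cong (suc (suc n)) reorder) ⟩
    - det (suc (suc n)) (M zero ▹ M (suc k) ▹ deleteRow k (M ∘ suc))
      ≈⟨ -‿cong (det-scaleMinors {M = M zero ▹ M (suc k) ▹ deleteRow k (M ∘ suc)} {M} (sign (toℕ k))
                   (λ c → refl) (λ c → trans (det-cong (suc n) (minor≈ c)) (det-rowToTop n (minor₀ c M) k))) ⟩
    - (sign (toℕ k) * det (suc (suc n)) M)
      ≈⟨ -‿distribˡ-* _ _ ⟩
    sign (toℕ (suc k)) * det (suc (suc n)) M ∎
    where
    reorder : ∀ a b → ((M (suc k) ▹ deleteRow (suc k) M) ∘ swap₀₁) a b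
                    ≈ (M zero ▹ M (suc k) ▹ deleteRow k (M ∘ suc)) a b
    reorder zero          b = refl
    reorder (suc zero)    b = refl
    reorder (suc (suc a)) b = refl
    minor≈ : ∀ c a b → minor₀ c (M zero ▹ M (suc k) ▹ deleteRow k (M ∘ suc)) a b
                     ≈ (minor₀ c M k ▹ deleteRow k (minor₀ c M)) a b
    minor≈ c zero    b = refl
    minor≈ c (suc a) b = refl

  det-repeatedRow : ∀ n (M : Matrix (suc (suc n))) r → (∀ b → M zero b ≈ M (suc r) b) →
    det (suc (suc n)) M ≈ 0#
  det-repeatedRow n M zero same = trans
    (det-cong (suc (suc n)) {M} {M zero ▹ M zero ▹ λ x → M (suc (suc x))}
       λ { zero b → refl ; (suc zero) b → sym (same b) ; (suc (suc a)) b → refl })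
    (expand₂-self n (M zero) (lowerCofactors-resp M))
  -- After swapping the first two rows, every minor along the top row has two equal rows.
  det-repeatedRow (suc n) M (suc r) same = begin
    det (suc (suc (suc n))) M
      ≈⟨ det-swap₀₁ M ⟩
    - det (suc (suc (suc n))) (M ∘ swap₀₁)
      ≈⟨ -‿cong (sum-zero λ c → trans (*-congˡ (det-repeatedRow n (minor₀ c (M ∘ swap₀₁)) r
                                                  (λ b → same (punchIn c b))))
                                       (zeroʳ (sign (toℕ c) * M (suc zero) c))) ⟩
    - 0#
      ≈⟨ -0#≈0# ⟩
    0# ∎

  minor : ∀ {n} → Fin (suc n) → Fin (suc n) → Matrix (suc n) → Matrix n
  minor k l M a b = M (punchIn k a) (punchIn l b)

  adjugate : ∀ {n} → Matrix (suc n) → Matrix (suc n)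
  adjugate {n} M l k = sign (toℕ k) * (sign (toℕ l) * det n (minor k l M))

  ⊗-adjugate : ∀ {n} (M : Matrix (suc n)) i k →
    (M ⊗ adjugate M) i k ≈ sign (toℕ k) * det (suc n) (M i ▹ deleteRow k M)
  ⊗-adjugate {n} M i k = trans (sum-cong-≋ regroup) (sym (*-distribˡ-sum (sign (toℕ k)) expansion))
    where
    expansion : Fin (suc n) → Carrier
    expansion l = sign (toℕ l) * M i l * det n (minor k l M)
    regroup : ∀ l → M i l * adjugate M l k ≈ sign (toℕ k) * expansion l
    regroup l = trans (x∙yz≈y∙xz (M i l) _ _)
                      (*-congˡ (trans (x∙yz≈y∙xz (M i l) _ _) (sym (*-assoc _ _ _))))

  ⊗-adjugate-diag : ∀ {n} (M : Matrix (suc n)) k → (M ⊗ adjugate M) k k ≈ det (suc n) M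
  ⊗-adjugate-diag {n} M k = begin
    (M ⊗ adjugate M) k k                      ≈⟨ ⊗-adjugate M k k ⟩
    s * det (suc n) (M k ▹ deleteRow k M)     ≈⟨ *-congˡ (det-rowToTop n M k) ⟩
    s * (s * det (suc n) M)                   ≈⟨ *-assoc _ _ _ ⟨
    s * s * det (suc n) M                     ≈⟨ *-congʳ (sign*sign≈1 (toℕ k)) ⟩
    1# * det (suc n) M                        ≈⟨ *-identityˡ _ ⟩
    det (suc n) M                             ∎
    where s = sign (toℕ k)

  ⊗-adjugate-offDiag : ∀ {n} (M : Matrix (suc n)) i k → i ≢ k → (M ⊗ adjugate M) i k ≈ 0#
  ⊗-adjugate-offDiag {zero}  M zero zero i≢k = ⊥-elim (i≢k ≡.refl)
  ⊗-adjugate-offDiag {suc n} M i k i≢k = begin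
    (M ⊗ adjugate M) i k                                ≈⟨ ⊗-adjugate M i k ⟩
    sign (toℕ k) * det (suc (suc n)) (M i ▹ deleteRow k M)
      ≈⟨ *-congˡ (det-repeatedRow n (M i ▹ deleteRow k M) (punchOut k≢i) λ b →
           reflexive (≡.cong (λ r → M r b) (≡.sym (Finₚ.punchIn-punchOut k≢i)))) ⟩
    sign (toℕ k) * 0#                                   ≈⟨ zeroʳ _ ⟩
    0#                                                  ∎
    where
    k≢i : k ≢ i
    k≢i = i≢k ∘ ≡.sym

  adjugate-diag : ∀ {n} (M : Matrix (suc n)) k → adjugate M k k ≈ det n (minor k k M)
  adjugate-diag M k = trans (sym (*-assoc _ _ _)) (trans (*-congʳ (sign*sign≈1 (toℕ k))) (*-identityˡ _))

-- Imported only here: inside the generic modules above these names would clash with the ring's.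
open import Data.Integer using (ℤ; +_; -_; _+_; _-_; _*_; 0ℤ; 1ℤ; -1ℤ)
import Data.Integer.Properties as ℤₚ
open import Data.Integer.Tactic.RingSolver using (solve-∀)

open import Defs

coeff-+P : ∀ p q k → coeff (p +P q) k ≡ coeff p k + coeff q k
coeff-+P []      q       k       = ≡.sym (ℤₚ.+-identityˡ (coeff q k))
coeff-+P (a ∷ p) []      k       = ≡.sym (ℤₚ.+-identityʳ (coeff (a ∷ p) k))
coeff-+P (a ∷ p) (b ∷ q) zero    = ≡.refl
coeff-+P (a ∷ p) (b ∷ q) (suc k) = coeff-+P p q k

coeff-scaleP : ∀ c p k → coeff (scaleP c p) k ≡ c * coeff p k
coeff-scaleP c []      k       = ≡.sym (ℤₚ.*-zeroʳ c)
coeff-scaleP c (a ∷ p) zero    = ≡.refl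
coeff-scaleP c (a ∷ p) (suc k) = coeff-scaleP c p k

coeff-negP : ∀ p k → coeff (negP p) k ≡ - coeff p k
coeff-negP []      k       = ≡.refl
coeff-negP (a ∷ p) zero    = ≡.refl
coeff-negP (a ∷ p) (suc k) = coeff-negP p k

-- A record around _≈P_, so that the two polynomials can be recovered from the type.
infix 4 _≋_
record _≋_ (p q : Poly) : Set where
  constructor ≈P⇒≋
  field ≋⇒≈P : p ≈P q
open _≋_ public

≋-refl : ∀ {p} → p ≋ p
≋-refl = ≈P⇒≋ λ k → ≡.refl

≋-sym : ∀ {p q} → p ≋ q → q ≋ p
≋-sym (≈P⇒≋ p≈q) = ≈P⇒≋ λ k → ≡.sym (p≈q k)

≋-trans : ∀ {p q r} → p ≋ q → q ≋ r → p ≋ r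
≋-trans (≈P⇒≋ p≈q) (≈P⇒≋ q≈r) = ≈P⇒≋ λ k → ≡.trans (p≈q k) (q≈r k)

∷-cong : ∀ {a b p q} → a ≡ b → p ≋ q → (a ∷ p) ≋ (b ∷ q)
∷-cong a≡b (≈P⇒≋ p≈q) = ≈P⇒≋ λ { zero → a≡b ; (suc k) → p≈q k }

+P-cong : ∀ {p p′ q q′} → p ≋ p′ → q ≋ q′ → p +P q ≋ p′ +P q′
+P-cong {p} {p′} {q} {q′} (≈P⇒≋ p≈p′) (≈P⇒≋ q≈q′) = ≈P⇒≋ λ k →
  ≡.trans (coeff-+P p q k) (≡.trans (cong₂ _+_ (p≈p′ k) (q≈q′ k)) (≡.sym (coeff-+P p′ q′ k)))

negP-cong : ∀ {p q} → p ≋ q → negP p ≋ negP q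
negP-cong {p} {q} (≈P⇒≋ p≈q) = ≈P⇒≋ λ k →
  ≡.trans (coeff-negP p k) (≡.trans (cong -_ (p≈q k)) (≡.sym (coeff-negP q k)))

scaleP-cong : ∀ c {p q} → p ≋ q → scaleP c p ≋ scaleP c q
scaleP-cong c {p} {q} (≈P⇒≋ p≈q) = ≈P⇒≋ λ k →
  ≡.trans (coeff-scaleP c p k) (≡.trans (cong (c *_) (p≈q k)) (≡.sym (coeff-scaleP c q k)))

+P-assoc : ∀ p q r → (p +P q) +P r ≋ p +P (q +P r)
+P-assoc p q r = ≈P⇒≋ λ k → begin
  coeff ((p +P q) +P r) k              ≡⟨ coeff-+P (p +P q) r k ⟩
  coeff (p +P q) k + coeff r k         ≡⟨ cong (_+ coeff r k) (coeff-+P p q k) ⟩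
  coeff p k + coeff q k + coeff r k    ≡⟨ ℤₚ.+-assoc (coeff p k) (coeff q k) (coeff r k) ⟩
  coeff p k + (coeff q k + coeff r k)  ≡⟨ cong (_+_ (coeff p k)) (coeff-+P q r k) ⟨
  coeff p k + coeff (q +P r) k         ≡⟨ coeff-+P p (q +P r) k ⟨
  coeff (p +P (q +P r)) k              ∎
  where open ≡.≡-Reasoning

+P-comm : ∀ p q → p +P q ≋ q +P p
+P-comm p q = ≈P⇒≋ λ k →
  ≡.trans (coeff-+P p q k) (≡.trans (ℤₚ.+-comm (coeff p k) (coeff q k)) (≡.sym (coeff-+P q p k)))

+P-identityʳ : ∀ p → p +P [] ≋ p
+P-identityʳ p = ≈P⇒≋ λ k → ≡.trans (coeff-+P p [] k) (ℤₚ.+-identityʳ (coeff p k))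

negP-inverseˡ : ∀ p → negP p +P p ≋ []
negP-inverseˡ p = ≈P⇒≋ λ k →
  ≡.trans (coeff-+P (negP p) p k) (≡.trans (cong (_+ coeff p k) (coeff-negP p k)) (ℤₚ.+-inverseˡ (coeff p k)))

+P-interchange : ∀ p q r s → (p +P q) +P (r +P s) ≋ (p +P r) +P (q +P s)
+P-interchange p q r s = ≈P⇒≋ λ k → begin
  coeff ((p +P q) +P (r +P s)) k
    ≡⟨ coeff-+P (p +P q) (r +P s) k ⟩
  coeff (p +P q) k + coeff (r +P s) k
    ≡⟨ cong₂ _+_ (coeff-+P p q k) (coeff-+P r s k) ⟩
  (coeff p k + coeff q k) + (coeff r k + coeff s k)
    ≡⟨ interchange (coeff p k) (coeff q k) (coeff r k) (coeff s k) ⟩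
  (coeff p k + coeff r k) + (coeff q k + coeff s k)
    ≡⟨ cong₂ _+_ (coeff-+P p r k) (coeff-+P q s k) ⟨
  coeff (p +P r) k + coeff (q +P s) k
    ≡⟨ coeff-+P (p +P r) (q +P s) k ⟨
  coeff ((p +P r) +P (q +P s)) k ∎
  where
  open ≡.≡-Reasoning
  interchange : ∀ w x y z → (w + x) + (y + z) ≡ (w + y) + (x + z)
  interchange = solve-∀

scaleP-distrib : ∀ a q r → scaleP a (q +P r) ≋ scaleP a q +P scaleP a r
scaleP-distrib a q r = ≈P⇒≋ λ k → begin
  coeff (scaleP a (q +P r)) k              ≡⟨ coeff-scaleP a (q +P r) k ⟩
  a * coeff (q +P r) k                     ≡⟨ cong (a *_) (coeff-+P q r k) ⟩
  a * (coeff q k + coeff r k)              ≡⟨ ℤₚ.*-distribˡ-+ a (coeff q k) (coeff r k) ⟩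
  a * coeff q k + a * coeff r k            ≡⟨ cong₂ _+_ (coeff-scaleP a q k) (coeff-scaleP a r k) ⟨
  coeff (scaleP a q) k + coeff (scaleP a r) k ≡⟨ coeff-+P (scaleP a q) (scaleP a r) k ⟨
  coeff (scaleP a q +P scaleP a r) k       ∎
  where open ≡.≡-Reasoning

scaleP-scaleP : ∀ a b r → scaleP (a * b) r ≋ scaleP a (scaleP b r)
scaleP-scaleP a b r = ≈P⇒≋ λ k → begin
  coeff (scaleP (a * b) r) k     ≡⟨ coeff-scaleP (a * b) r k ⟩
  a * b * coeff r k              ≡⟨ ℤₚ.*-assoc a b (coeff r k) ⟩
  a * (b * coeff r k)            ≡⟨ cong (a *_) (coeff-scaleP b r k) ⟨
  a * coeff (scaleP b r) k       ≡⟨ coeff-scaleP a (scaleP b r) k ⟨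
  coeff (scaleP a (scaleP b r)) k ∎
  where open ≡.≡-Reasoning

scaleP-zero : ∀ r → scaleP 0ℤ r ≋ []
scaleP-zero r = ≈P⇒≋ λ k → ≡.trans (coeff-scaleP 0ℤ r k) (ℤₚ.*-zeroˡ (coeff r k))

*P-congʳ : ∀ p {q q′} → q ≋ q′ → p *P q ≋ p *P q′
*P-congʳ []      q≋q′ = ≋-refl
*P-congʳ (a ∷ p) q≋q′ = +P-cong (scaleP-cong a q≋q′) (∷-cong ≡.refl (*P-congʳ p q≋q′))

*P-zeroʳ : ∀ p → p *P [] ≋ []
*P-zeroʳ []      = ≋-refl
*P-zeroʳ (a ∷ p) = ≈P⇒≋ λ { zero → ≡.refl ; (suc k) → ≋⇒≈P (*P-zeroʳ p) k }

*P-∷ʳ : ∀ p b q → p *P (b ∷ q) ≋ scaleP b p +P (0ℤ ∷ p *P q)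
*P-∷ʳ []      b q = ≈P⇒≋ λ { zero → ≡.refl ; (suc k) → ≡.refl }
*P-∷ʳ (a ∷ p) b q = ∷-cong (cong (_+ 0ℤ) (ℤₚ.*-comm a b)) (≈P⇒≋ λ k → begin
  coeff (scaleP a q +P p *P (b ∷ q)) k
    ≡⟨ coeff-+P (scaleP a q) (p *P (b ∷ q)) k ⟩
  coeff (scaleP a q) k + coeff (p *P (b ∷ q)) k
    ≡⟨ cong (_+_ (coeff (scaleP a q) k)) (≋⇒≈P (*P-∷ʳ p b q) k) ⟩
  coeff (scaleP a q) k + coeff (scaleP b p +P (0ℤ ∷ p *P q)) k
    ≡⟨ cong (_+_ (coeff (scaleP a q) k)) (coeff-+P (scaleP b p) (0ℤ ∷ p *P q) k) ⟩
  coeff (scaleP a q) k + (coeff (scaleP b p) k + coeff (0ℤ ∷ p *P q) k)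
    ≡⟨ swap (coeff (scaleP a q) k) (coeff (scaleP b p) k) (coeff (0ℤ ∷ p *P q) k) ⟩
  coeff (scaleP b p) k + (coeff (scaleP a q) k + coeff (0ℤ ∷ p *P q) k)
    ≡⟨ cong (_+_ (coeff (scaleP b p) k)) (coeff-+P (scaleP a q) (0ℤ ∷ p *P q) k) ⟨
  coeff (scaleP b p) k + coeff (scaleP a q +P (0ℤ ∷ p *P q)) k
    ≡⟨ coeff-+P (scaleP b p) (scaleP a q +P (0ℤ ∷ p *P q)) k ⟨
  coeff (scaleP b p +P (scaleP a q +P (0ℤ ∷ p *P q))) k ∎)
  where
  open ≡.≡-Reasoning
  swap : ∀ x y z → x + (y + z) ≡ y + (x + z)
  swap = solve-∀

*P-comm : ∀ p q → p *P q ≋ q *P p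
*P-comm []      q = ≋-sym (*P-zeroʳ q)
*P-comm (a ∷ p) q = ≋-trans (+P-cong ≋-refl (∷-cong ≡.refl (*P-comm p q))) (≋-sym (*P-∷ʳ q a p))

*P-distribˡ : ∀ p q r → p *P (q +P r) ≋ p *P q +P p *P r
*P-distribˡ []      q r = ≋-refl
*P-distribˡ (a ∷ p) q r = ≋-trans
  (+P-cong (scaleP-distrib a q r) (∷-cong ≡.refl (*P-distribˡ p q r)))
  (+P-interchange (scaleP a q) (scaleP a r) (0ℤ ∷ p *P q) (0ℤ ∷ p *P r))

*P-distribʳ : ∀ r p q → (p +P q) *P r ≋ p *P r +P q *P r
*P-distribʳ r p q = ≋-trans (*P-comm (p +P q) r)
  (≋-trans (*P-distribˡ r p q) (+P-cong (*P-comm r p) (*P-comm r q)))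

*P-cong : ∀ {p p′ q q′} → p ≋ p′ → q ≋ q′ → p *P q ≋ p′ *P q′
*P-cong {p} {p′} {q} {q′} p≋p′ q≋q′ = ≋-trans (*P-congʳ p q≋q′)
  (≋-trans (*P-comm p q′) (≋-trans (*P-congʳ q′ p≋p′) (*P-comm q′ p′)))

scaleP-*P : ∀ a q r → scaleP a q *P r ≋ scaleP a (q *P r)
scaleP-*P a []      r = ≋-refl
scaleP-*P a (b ∷ q) r = ≋-trans
  (+P-cong (scaleP-scaleP a b r) (∷-cong ≡.refl (scaleP-*P a q r)))
  (≋-sym (≋-trans (scaleP-distrib a (scaleP b r) (0ℤ ∷ q *P r))
                  (+P-cong ≋-refl (∷-cong (ℤₚ.*-zeroʳ a) ≋-refl))))

*P-assoc : ∀ p q r → (p *P q) *P r ≋ p *P (q *P r)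
*P-assoc []      q r = ≋-refl
*P-assoc (a ∷ p) q r = ≋-trans (*P-distribʳ r (scaleP a q) (0ℤ ∷ p *P q))
  (+P-cong (scaleP-*P a q r) (+P-cong (scaleP-zero r) (∷-cong ≡.refl (*P-assoc p q r))))

*P-identityˡ : ∀ p → constP 1ℤ *P p ≋ p
*P-identityˡ p = ≈P⇒≋ λ k → begin
  coeff (scaleP 1ℤ p +P (0ℤ ∷ [])) k    ≡⟨ coeff-+P (scaleP 1ℤ p) (0ℤ ∷ []) k ⟩
  coeff (scaleP 1ℤ p) k + coeff (0ℤ ∷ []) k ≡⟨ cong₂ _+_ (coeff-scaleP 1ℤ p k) (coeff-0∷[] k) ⟩
  1ℤ * coeff p k + 0ℤ                  ≡⟨ ℤₚ.+-identityʳ _ ⟩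
  1ℤ * coeff p k                       ≡⟨ ℤₚ.*-identityˡ (coeff p k) ⟩
  coeff p k                            ∎
  where
  open ≡.≡-Reasoning
  coeff-0∷[] : ∀ k → coeff (0ℤ ∷ []) k ≡ 0ℤ
  coeff-0∷[] zero    = ≡.refl
  coeff-0∷[] (suc k) = ≡.refl

ℤ[X] : CommutativeRing 0ℓ 0ℓ
ℤ[X] = record
  { Carrier = Poly ; _≈_ = _≋_ ; _+_ = _+P_ ; _*_ = _*P_ ; -_ = negP ; 0# = [] ; 1# = constP 1ℤ
  ; isCommutativeRing = record
    { isRing = record
      { +-isAbelianGroup = record
        { isGroup = record
          { isMonoid = record
            { isSemigroup = record
              { isMagma = record
                { isEquivalence = record { refl = ≋-refl ; sym = ≋-sym ; trans = ≋-trans }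
                ; ∙-cong = +P-cong }
              ; assoc = +P-assoc }
            ; identity = (λ p → ≋-refl) , +P-identityʳ }
          ; inverse = negP-inverseˡ , (λ p → ≋-trans (+P-comm p (negP p)) (negP-inverseˡ p))
          ; ⁻¹-cong = negP-cong }
        ; comm = +P-comm }
      ; *-cong = *P-cong
      ; *-assoc = *P-assoc
      ; *-identity = *P-identityˡ , (λ p → ≋-trans (*P-comm p (constP 1ℤ)) (*P-identityˡ p))
      ; distrib = *P-distribˡ , *P-distribʳ }
    ; *-comm = *P-comm } }

sumFin≡sum : ∀ {ℓ} (R : CommutativeRing 0ℓ ℓ) (let module R = CommutativeRing R) n (f : Fin n → R.Carrier) →
             sumFin R._+_ R.0# n f ≡ Determinant.sum R f
sumFin≡sum R zero    f = ≡.refl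
sumFin≡sum R (suc n) f = cong (CommutativeRing._+_ R (f zero)) (sumFin≡sum R n (f ∘ suc))

module Dℤ = Determinant ℤₚ.+-*-commutativeRing
module D[X] = Determinant ℤ[X]
module ℤ[X]ₚ = RingProperties (CommutativeRing.ring ℤ[X])
module ≋-Reasoning = SetoidReasoning (CommutativeRing.setoid ℤ[X])
module ℤ[X]-Identities = RingIdentities ℤ[X]

≋-reflexive : ∀ {p q} → p ≡ q → p ≋ q
≋-reflexive ≡.refl = ≋-refl

constP-0 : constP 0ℤ ≋ []
constP-0 = ≈P⇒≋ λ { zero → ≡.refl ; (suc k) → ≡.refl }

constP-* : ∀ a b → constP (a * b) ≋ constP a *P constP b
constP-* a b = ≈P⇒≋ λ { zero → ≡.sym (ℤₚ.+-identityʳ (a * b)) ; (suc k) → ≡.refl }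

constP-sum : ∀ n (f : Fin n → ℤ) → constP (Dℤ.sum f) ≋ D[X].sum (constP ∘ f)
constP-sum zero    f = constP-0
constP-sum (suc n) f = +P-cong ≋-refl (constP-sum n (f ∘ suc))

coeff-sum : ∀ n (f : Fin n → Poly) t → coeff (D[X].sum f) t ≡ Dℤ.sum (λ l → coeff (f l) t)
coeff-sum zero    f t = ≡.refl
coeff-sum (suc n) f t = ≡.trans (coeff-+P (f zero) _ t) (cong (_+_ (coeff (f zero) t)) (coeff-sum n (f ∘ suc) t))

constP-*P : ∀ c u → constP c *P u ≋ scaleP c u
constP-*P c u = ≋-trans (+P-cong ≋-refl constP-0) (+P-identityʳ (scaleP c u))

coeff-constP*P : ∀ c u t → coeff (constP c *P u) t ≡ c * coeff u t
coeff-constP*P c u t = ≡.trans (≋⇒≈P (constP-*P c u) t) (coeff-scaleP c u t)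

coeff-X*P : ∀ u t → coeff (X *P u) t ≡ coeff (0ℤ ∷ u) t
coeff-X*P u t = begin
  coeff (scaleP 0ℤ u +P (0ℤ ∷ constP 1ℤ *P u)) t
    ≡⟨ ≋⇒≈P (+P-cong (scaleP-zero u) (∷-cong ≡.refl (*P-identityˡ u))) t ⟩
  coeff (0ℤ ∷ u) t ∎
  where open ≡.≡-Reasoning

∷≋constP+X*P : ∀ c p → (c ∷ p) ≋ constP c +P X *P p
∷≋constP+X*P c p = ≈P⇒≋ λ t → ≡.sym (≡.trans (coeff-+P (constP c) (X *P p) t) (split t))
  where
  split : ∀ t → coeff (constP c) t + coeff (X *P p) t ≡ coeff (c ∷ p) t
  split zero    = ≡.trans (cong (_+_ c) (coeff-X*P p zero)) (ℤₚ.+-identityʳ c)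
  split (suc t) = ≡.trans (ℤₚ.+-identityˡ _) (coeff-X*P p (suc t))

identityM-diag : ∀ {n} (i : Fin n) → identityM i i ≡ 1ℤ
identityM-diag i with i ≟ i
... | yes _  = ≡.refl
... | no i≢i = ⊥-elim (i≢i ≡.refl)

identityM-offDiag : ∀ {n} {i k : Fin n} → i ≢ k → identityM i k ≡ 0ℤ
identityM-offDiag {i = i} {k} i≢k with i ≟ k
... | yes i≡k = ⊥-elim (i≢k i≡k)
... | no  _   = ≡.refl

constM : ∀ {n} → Mat ℤ n → Mat Poly n
constM M i k = constP (M i k)

I[X] : ∀ {n} → Mat Poly n
I[X] = constM identityM

I[X]-⊗ : ∀ {n} (i : Fin n) (f : Fin n → Poly) → D[X].sum (λ l → I[X] i l *P f l) ≋ f i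
I[X]-⊗ {suc n} i f = ≋-trans (D[X].sum-single (λ l → I[X] i l *P f l) i vanish) diag
  where
  vanish : ∀ l → l ≢ i → I[X] i l *P f l ≋ []
  vanish l l≢i = *P-cong (≋-trans (≋-reflexive (cong constP (identityM-offDiag (l≢i ∘ ≡.sym)))) constP-0)
                         (≋-refl {f l})
  diag : I[X] i i *P f i ≋ f i
  diag = ≋-trans (*P-cong (≋-reflexive (cong constP (identityM-diag i))) ≋-refl) (*P-identityˡ (f i))

-- The matrix xI − S of charPoly is local to its definition; unification recovers it.
charMatrix : ∀ {n} → Mat ℤ n → Mat Poly n
charMatrix {n} S = proj₁ {B = λ E → charPoly S ≡ detP n E} (_ , ≡.refl)

charMatrix-entry : ∀ {n} (S : Mat ℤ n) i k → charMatrix S i k ≋ X *P I[X] i k +P negP (constM S i k)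
charMatrix-entry S i k with i ≟ k
... | yes _ = +P-cong (≋-sym (CommutativeRing.*-identityʳ ℤ[X] X)) (≋-refl {constP (- S i k)})
... | no  _ = ≋-sym (+P-cong (≋-trans (*P-congʳ X constP-0) (*P-zeroʳ X)) (≋-refl {constP (- S i k)}))

signP≋sign : ∀ k → signP k ≋ D[X].sign k
signP≋sign zero          = ≋-refl
signP≋sign (suc zero)    = ≋-refl
signP≋sign (suc (suc k)) = ≋-trans (signP≋sign k) (≋-sym (ℤ[X]ₚ.-‿involutive (D[X].sign k)))

detP≋det : ∀ n (M : Mat Poly n) → detP n M ≋ D[X].det n M
detP≋det zero    M = ≋-refl
detP≋det (suc n) M = ≋-trans (≋-reflexive (sumFin≡sum ℤ[X] (suc n) (term signP detP)))
  (D[X].sum-cong-≋ {x = term signP detP} {y = term D[X].sign D[X].det} λ k →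
    *P-cong (*P-cong (signP≋sign (toℕ k)) ≋-refl) (detP≋det n (D[X].minor₀ k M)))
  where
  term : (ℕ → Poly) → (∀ n → Mat Poly n → Poly) → Fin (suc n) → Poly
  term sign det k = sign (toℕ k) *P M zero k *P det n (D[X].minor₀ k M)

charPoly≋det : ∀ {n} (S : Mat ℤ n) → charPoly S ≋ D[X].det n (charMatrix S)
charPoly≋det {n} S = detP≋det n (charMatrix S)

charMatrix-⊗ : ∀ {n} (S : Mat ℤ n) (D : Mat Poly n) i k →
  (charMatrix S D[X].⊗ D) i k ≋ X *P D i k +P negP ((constM S D[X].⊗ D) i k)
charMatrix-⊗ {n} S D i k = begin
  D[X].sum (λ l → charMatrix S i l *P D l k)
    ≈⟨ D[X].sum-cong-≋ {x = λ l → charMatrix S i l *P D l k} {y = λ l → x-part l +P s-part l} split ⟩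
  D[X].sum (λ l → x-part l +P s-part l)
    ≈⟨ D[X].∑-distrib-+ x-part s-part ⟩
  D[X].sum x-part +P D[X].sum s-part
    ≈⟨ +P-cong x-sum s-sum ⟩
  X *P D i k +P negP ((constM S D[X].⊗ D) i k) ∎
  where
  open ≋-Reasoning
  x-part s-part : Fin n → Poly
  x-part l = X *P (I[X] i l *P D l k)
  s-part l = negP (constM S i l *P D l k)
  split : ∀ l → charMatrix S i l *P D l k ≋ x-part l +P s-part l
  split l = ≋-trans (*P-cong (charMatrix-entry S i l) ≋-refl)
    (≋-trans (*P-distribʳ (D l k) (X *P I[X] i l) (negP (constM S i l)))
             (+P-cong (*P-assoc X (I[X] i l) (D l k)) (≋-sym (ℤ[X]ₚ.-‿distribˡ-* (constM S i l) (D l k)))))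
  x-sum : D[X].sum x-part ≋ X *P D i k
  x-sum = ≋-trans (≋-sym (D[X].*-distribˡ-sum X (λ l → I[X] i l *P D l k))) (*P-congʳ X (I[X]-⊗ i (λ l → D l k)))
  s-sum : D[X].sum s-part ≋ negP ((constM S D[X].⊗ D) i k)
  s-sum = ≋-sym (D[X].-‿distrib-sum (λ l → constM S i l *P D l k))

coeffMatrix : ∀ {n} → Mat Poly n → ℕ → Mat ℤ n
coeffMatrix D t i k = coeff (D i k) t

coeff-charMatrix-⊗ : ∀ {n} (S : Mat ℤ n) (D : Mat Poly n) i k t →
  coeff ((charMatrix S D[X].⊗ D) i k) t ≡ coeff (0ℤ ∷ D i k) t - (S Dℤ.⊗ coeffMatrix D t) i k
coeff-charMatrix-⊗ {n} S D i k t = begin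
  coeff ((charMatrix S D[X].⊗ D) i k) t
    ≡⟨ ≋⇒≈P (charMatrix-⊗ S D i k) t ⟩
  coeff (X *P D i k +P negP ((constM S D[X].⊗ D) i k)) t
    ≡⟨ coeff-+P (X *P D i k) (negP ((constM S D[X].⊗ D) i k)) t ⟩
  coeff (X *P D i k) t + coeff (negP ((constM S D[X].⊗ D) i k)) t
    ≡⟨ cong₂ _+_ (coeff-X*P (D i k) t) (coeff-negP ((constM S D[X].⊗ D) i k) t) ⟩
  coeff (0ℤ ∷ D i k) t - coeff ((constM S D[X].⊗ D) i k) t
    ≡⟨ cong (λ x → coeff (0ℤ ∷ D i k) t - x) (coeff-sum n (λ l → constM S i l *P D l k) t) ⟩
  coeff (0ℤ ∷ D i k) t - Dℤ.sum (λ l → coeff (constM S i l *P D l k) t)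
    ≡⟨ cong (λ x → coeff (0ℤ ∷ D i k) t - x)
         (Dℤ.sum-cong-≋ {x = λ l → coeff (constM S i l *P D l k) t} {y = λ l → S i l * coeff (D l k) t}
                        (λ l → coeff-constP*P (S i l) (D l k) t)) ⟩
  coeff (0ℤ ∷ D i k) t - (S Dℤ.⊗ coeffMatrix D t) i k ∎
  where open ≡.≡-Reasoning

⊗-vanishingʳ : ∀ {n} (A B : Mat ℤ n) → (∀ i k → B i k ≡ 0ℤ) → ∀ i k → (A Dℤ.⊗ B) i k ≡ 0ℤ
⊗-vanishingʳ A B B≡0 i k = Dℤ.sum-zero λ l → ≡.trans (cong (A i l *_) (B≡0 l k)) (ℤₚ.*-zeroʳ (A i l))

vanish-by-descent : ∀ {n} (S : Mat ℤ n) (E : ℕ → Mat ℤ n) N →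
  (∀ t i k → E t i k ≡ (S Dℤ.⊗ E (suc t)) i k) → (∀ t → N ≤ t → ∀ i k → E t i k ≡ 0ℤ) →
  ∀ t i k → E t i k ≡ 0ℤ
vanish-by-descent S E N step eventually t = descend (N ∸ t) t (ℕₚ.m≤n+m∸n N t)
  where
  descend : ∀ s t → N ≤ t ℕ.+ s → ∀ i k → E t i k ≡ 0ℤ
  descend zero    t N≤t   = eventually t (≡.subst (N ≤_) (ℕₚ.+-identityʳ t) N≤t)
  descend (suc s) t N≤t+s i k = ≡.trans (step t i k)
    (⊗-vanishingʳ S (E (suc t)) (descend s (suc t) (≡.subst (N ≤_) (ℕₚ.+-suc t s) N≤t+s)) i k)

≤-sumFin : ∀ n (f : Fin n → ℕ) i → f i ≤ sumFin ℕ._+_ 0 n f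
≤-sumFin (suc n) f zero    = ℕₚ.m≤m+n (f zero) _
≤-sumFin (suc n) f (suc i) = ℕₚ.≤-trans (≤-sumFin n (f ∘ suc) i) (ℕₚ.m≤n+m _ (f zero))

coeff-≥length : ∀ p t → length p ≤ t → coeff p t ≡ 0ℤ
coeff-≥length []      t       _         = ≡.refl
coeff-≥length (c ∷ p) (suc t) (s≤s len) = coeff-≥length p t len

lengthBound : ∀ {n} → Mat Poly n → ℕ
lengthBound {n} D = sumFin ℕ._+_ 0 n λ i → sumFin ℕ._+_ 0 n λ k → length (D i k)

coeffMatrix-lengthBound : ∀ {n} (D : Mat Poly n) t → lengthBound D ≤ t → ∀ i k → coeffMatrix D t i k ≡ 0ℤ
coeffMatrix-lengthBound {n} D t bound≤t i k = coeff-≥length (D i k) t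
  (ℕₚ.≤-trans (≤-sumFin n (λ k → length (D i k)) k)
  (ℕₚ.≤-trans (≤-sumFin n (λ i → sumFin ℕ._+_ 0 n λ k → length (D i k)) i) bound≤t))

charMatrix-⊗-const⇒0 : ∀ {n} (S : Mat ℤ n) (D : Mat Poly n) (C : Mat ℤ n) →
  (∀ i k → (charMatrix S D[X].⊗ D) i k ≋ constM C i k) →
  (∀ i k → D i k ≋ []) × (∀ i k → C i k ≡ 0ℤ)
charMatrix-⊗-const⇒0 {n} S D C SD≋C = (λ i k → ≈P⇒≋ λ t → D≡0 t i k) , C≡0
  where
  coeff-equation : ∀ t i k → coeff (0ℤ ∷ D i k) t - (S Dℤ.⊗ coeffMatrix D t) i k ≡ coeff (constM C i k) t
  coeff-equation t i k = ≡.trans (≡.sym (coeff-charMatrix-⊗ S D i k t)) (≋⇒≈P (SD≋C i k) t)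
  step : ∀ t i k → coeffMatrix D t i k ≡ (S Dℤ.⊗ coeffMatrix D (suc t)) i k
  step t i k = ℤₚ.i-j≡0⇒i≡j _ _ (coeff-equation (suc t) i k)
  D≡0 : ∀ t i k → coeffMatrix D t i k ≡ 0ℤ
  D≡0 = vanish-by-descent S (coeffMatrix D) (lengthBound D) step (coeffMatrix-lengthBound D)
  C≡0 : ∀ i k → C i k ≡ 0ℤ
  C≡0 i k = ≡.trans (≡.sym (coeff-equation 0 i k))
                    (cong (λ x → 0ℤ - x) (⊗-vanishingʳ S (coeffMatrix D 0) (D≡0 0) i k))

evalM-∷ : ∀ {n} (S : Mat ℤ n) c p i k → evalM (c ∷ p) S i k ≡ c * identityM i k + (S Dℤ.⊗ evalM p S) i k
evalM-∷ {n} S c p i k =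
  cong (_+_ (c * identityM i k)) (sumFin≡sum ℤₚ.+-*-commutativeRing n (λ l → S i l * evalM p S l k))

constM-⊗ : ∀ {n} (S E : Mat ℤ n) i k → (constM S D[X].⊗ constM E) i k ≋ constP ((S Dℤ.⊗ E) i k)
constM-⊗ {n} S E i k = ≋-trans
  (D[X].sum-cong-≋ {x = λ l → constM S i l *P constM E l k} {y = λ l → constP (S i l * E l k)}
                   (λ l → ≋-sym (constP-* (S i l) (E l k))))
  (≋-sym (constP-sum n (λ l → S i l * E l k)))

-- quotient S p = (p(x) I − p(S)) (x I − S)⁻¹, computed by Horner's scheme.
quotient : ∀ {n} → Mat ℤ n → Poly → Mat Poly n
quotient S []      i k = []
quotient S (c ∷ p) i k = X *P quotient S p i k +P constM (evalM p S) i k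

charMatrix-⊗-quotient : ∀ {n} (S : Mat ℤ n) p i k →
  (charMatrix S D[X].⊗ quotient S p) i k ≋ I[X] i k *P p +P negP (constP (evalM p S i k))
charMatrix-⊗-quotient {n} S [] i k = begin
  D[X].sum (λ l → charMatrix S i l *P [])  ≈⟨ D[X].sum-zero (λ l → *P-zeroʳ (charMatrix S i l)) ⟩
  []                                       ≈⟨ +P-cong (*P-zeroʳ (I[X] i k)) constP-0 ⟨
  I[X] i k *P [] +P negP (constP 0ℤ)       ∎
  where open ≋-Reasoning
charMatrix-⊗-quotient {n} S (c ∷ p) i k = begin
  (A D[X].⊗ quotient S (c ∷ p)) i k
    ≈⟨ D[X].⊗-distribˡ-+ A (λ a b → X *P quotient S p a b) (constM E) i k ⟩
  (A D[X].⊗ (λ a b → X *P quotient S p a b)) i k +P (A D[X].⊗ constM E) i k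
    ≈⟨ +P-cong (D[X].⊗-scaleʳ A (quotient S p) X i k) (charMatrix-⊗ S (constM E) i k) ⟩
  X *P (A D[X].⊗ quotient S p) i k +P (X *P constP (E i k) +P negP ((constM S D[X].⊗ constM E) i k))
    ≈⟨ +P-cong (*P-congʳ X (charMatrix-⊗-quotient S p i k))
               (+P-cong (≋-refl {X *P constP (E i k)}) (negP-cong (constM-⊗ S E i k))) ⟩
  X *P (I[X] i k *P p +P negP (constP (E i k))) +P (X *P constP (E i k) +P negP (constP (SE i k)))
    ≈⟨ ℤ[X]-Identities.x*[y-z]+[x*z-w]≈x*y-w X (I[X] i k *P p) (constP (E i k)) (constP (SE i k)) ⟩
  X *P (I[X] i k *P p) +P negP (constP (SE i k))
    ≈⟨ ℤ[X]-Identities.x-y≈[z+x]-[z+y] (X *P (I[X] i k *P p)) (constP (SE i k)) (constP (c * identityM i k)) ⟩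
  (constP (c * identityM i k) +P X *P (I[X] i k *P p)) +P negP (constP (c * identityM i k) +P constP (SE i k))
    ≈⟨ +P-cong leading (negP-cong (≋-reflexive (cong constP (≡.sym (evalM-∷ S c p i k))))) ⟩
  I[X] i k *P (c ∷ p) +P negP (constP (evalM (c ∷ p) S i k)) ∎
  where
  open ≋-Reasoning
  A = charMatrix S
  E = evalM p S
  SE = S Dℤ.⊗ E
  leading : constP (c * identityM i k) +P X *P (I[X] i k *P p) ≋ I[X] i k *P (c ∷ p)
  leading = begin
    constP (c * identityM i k) +P X *P (I[X] i k *P p)
      ≈⟨ +P-cong (≋-reflexive (cong constP (ℤₚ.*-comm c (identityM i k)))) (≋-sym (*P-assoc X (I[X] i k) p)) ⟩
    constP (identityM i k * c) +P (X *P I[X] i k) *P p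
      ≈⟨ +P-cong (constP-* (identityM i k) c) (*P-cong (*P-comm X (I[X] i k)) (≋-refl {p})) ⟩
    I[X] i k *P constP c +P (I[X] i k *P X) *P p
      ≈⟨ +P-cong (≋-refl {I[X] i k *P constP c}) (*P-assoc (I[X] i k) X p) ⟩
    I[X] i k *P constP c +P I[X] i k *P (X *P p)
      ≈⟨ *P-distribˡ (I[X] i k) (constP c) (X *P p) ⟨
    I[X] i k *P (constP c +P X *P p)
      ≈⟨ *P-congʳ (I[X] i k) (∷≋constP+X*P c p) ⟨
    I[X] i k *P (c ∷ p) ∎

charMatrix-⊗-adjugate : ∀ {n} (S : Mat ℤ (suc n)) i k →
  (charMatrix S D[X].⊗ D[X].adjugate (charMatrix S)) i k ≋ I[X] i k *P charPoly S
charMatrix-⊗-adjugate S i k with i ≟ k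
... | yes ≡.refl = ≋-trans (D[X].⊗-adjugate-diag (charMatrix S) i)
                           (≋-sym (≋-trans (*P-identityˡ (charPoly S)) (charPoly≋det S)))
... | no  i≢k    = ≋-trans (D[X].⊗-adjugate-offDiag (charMatrix S) i k i≢k)
                           (≋-sym (*P-cong constP-0 ≋-refl))

coeff-drop : ∀ k p t → coeff (drop k p) t ≡ coeff p (k ℕ.+ t)
coeff-drop zero    p       t = ≡.refl
coeff-drop (suc k) []      t = ≡.refl
coeff-drop (suc k) (c ∷ p) t = coeff-drop k p t

quotient-coeff : ∀ {n} (S : Mat ℤ n) p i k t → coeff (quotient S p i k) t ≡ evalM (drop (suc t) p) S i k
quotient-coeff S []      i k t       = ≡.refl
quotient-coeff S (c ∷ p) i k zero    = begin
  coeff (X *P quotient S p i k +P constM (evalM p S) i k) 0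
    ≡⟨ coeff-+P (X *P quotient S p i k) (constM (evalM p S) i k) 0 ⟩
  coeff (X *P quotient S p i k) 0 + evalM p S i k  ≡⟨ cong (_+ evalM p S i k) (coeff-X*P (quotient S p i k) 0) ⟩
  0ℤ + evalM p S i k                               ≡⟨ ℤₚ.+-identityˡ (evalM p S i k) ⟩
  evalM p S i k                                    ∎
  where open ≡.≡-Reasoning
quotient-coeff S (c ∷ p) i k (suc t) = begin
  coeff (X *P quotient S p i k +P constM (evalM p S) i k) (suc t)
    ≡⟨ coeff-+P (X *P quotient S p i k) (constM (evalM p S) i k) (suc t) ⟩
  coeff (X *P quotient S p i k) (suc t) + 0ℤ
    ≡⟨ ℤₚ.+-identityʳ _ ⟩
  coeff (X *P quotient S p i k) (suc t)
    ≡⟨ coeff-X*P (quotient S p i k) (suc t) ⟩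
  coeff (quotient S p i k) t
    ≡⟨ quotient-coeff S p i k t ⟩
  evalM (drop (suc t) p) S i k ∎
  where open ≡.≡-Reasoning

evalM-≈[] : ∀ {n} (S : Mat ℤ n) p → p ≈P [] → ∀ i k → evalM p S i k ≡ 0ℤ
evalM-≈[] S []      p≈0 i k = ≡.refl
evalM-≈[] S (c ∷ p) p≈0 i k = begin
  evalM (c ∷ p) S i k                            ≡⟨ evalM-∷ S c p i k ⟩
  c * identityM i k + (S Dℤ.⊗ evalM p S) i k     ≡⟨ cong₂ (λ x y → x * identityM i k + y) (p≈0 0)
                                                      (⊗-vanishingʳ S (evalM p S) (evalM-≈[] S p (p≈0 ∘ suc)) i k) ⟩
  0ℤ * identityM i k + 0ℤ                        ≡⟨ ℤₚ.+-identityʳ _ ⟩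
  0ℤ * identityM i k                             ≡⟨ ℤₚ.*-zeroˡ (identityM i k) ⟩
  0ℤ                                             ∎
  where open ≡.≡-Reasoning

quotient-≈[] : ∀ {n} (S : Mat ℤ n) p → p ≈P [] → ∀ i k → quotient S p i k ≋ []
quotient-≈[] S p p≈0 i k = ≈P⇒≋ λ t → ≡.trans (quotient-coeff S p i k t)
  (evalM-≈[] S (drop (suc t) p) (λ u → ≡.trans (coeff-drop (suc t) p u) (p≈0 (suc t ℕ.+ u))) i k)

MonicOfDegree : ℕ → Poly → Set
MonicOfDegree d m = coeff m d ≡ 1ℤ × (∀ k → d < k → coeff m k ≡ 0ℤ)

DegreeBelow : ℕ → Poly → Set
DegreeBelow d r = ∀ k → d ≤ k → coeff r k ≡ 0ℤ

divideByMonic : ∀ d {m} → MonicOfDegree (suc d) m → ∀ f →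
  ∃[ q ] ∃[ r ] (f ≋ q *P m +P r × DegreeBelow (suc d) r)
divideByMonic d monic []      = [] , [] , ≋-refl , λ _ _ → ≡.refl
divideByMonic d {m} monic@(m-lead , m-high) (c ∷ f) with divideByMonic d monic f
... | q , r , f≋qm+r , r<d = lc ∷ q , r′ , c∷f≋ , r′<d
  where
  lc = coeff r d
  r′ = (c ∷ r) +P negP (scaleP lc m)
  c∷f≋ : c ∷ f ≋ (lc ∷ q) *P m +P r′
  c∷f≋ = ≋-sym (begin
    (scaleP lc m +P (0ℤ ∷ q *P m)) +P ((c ∷ r) +P negP (scaleP lc m))
      ≈⟨ ℤ[X]-Identities.[x+y]+[z-x]≈y+z (scaleP lc m) (0ℤ ∷ q *P m) (c ∷ r) ⟩
    (0ℤ ∷ q *P m) +P (c ∷ r)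
      ≈⟨ ∷-cong (ℤₚ.+-identityˡ c) (≋-sym f≋qm+r) ⟩
    c ∷ f ∎)
    where open ≋-Reasoning
  r′-coeff : ∀ t → coeff r′ (suc t) ≡ coeff r t - lc * coeff m (suc t)
  r′-coeff t = ≡.trans (coeff-+P (c ∷ r) (negP (scaleP lc m)) (suc t))
    (cong (_+_ (coeff r t)) (≡.trans (coeff-negP (scaleP lc m) (suc t)) (cong -_ (coeff-scaleP lc m (suc t)))))
  r′<d : DegreeBelow (suc d) r′
  r′<d (suc t) (s≤s d≤t) with ℕₚ.m≤n⇒m<n∨m≡n d≤t
  ... | inj₂ ≡.refl = begin
    coeff r′ (suc d)                 ≡⟨ r′-coeff d ⟩
    lc - lc * coeff m (suc d)        ≡⟨ cong (λ x → lc - lc * x) m-lead ⟩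
    lc - lc * 1ℤ                     ≡⟨ cong (λ x → lc - x) (ℤₚ.*-identityʳ lc) ⟩
    lc - lc                          ≡⟨ ℤₚ.+-inverseʳ lc ⟩
    0ℤ                               ∎
    where open ≡.≡-Reasoning
  ... | inj₁ d<t = begin
    coeff r′ (suc t)                 ≡⟨ r′-coeff t ⟩
    coeff r t - lc * coeff m (suc t) ≡⟨ cong₂ (λ x y → x - lc * y) (r<d t d<t) (m-high (suc t) (s≤s d<t)) ⟩
    0ℤ - lc * 0ℤ                     ≡⟨ cong (λ x → 0ℤ - x) (ℤₚ.*-zeroʳ lc) ⟩
    0ℤ                               ∎
    where open ≡.≡-Reasoning

charMatrix-⊗-quotient-annihilating : ∀ {n} (S : Mat ℤ n) p → Annihilates p S →
  ∀ i k → (charMatrix S D[X].⊗ quotient S p) i k ≋ I[X] i k *P p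
charMatrix-⊗-quotient-annihilating S p p[S]≡0 i k = ≋-trans (charMatrix-⊗-quotient S p i k)
  (≋-trans (+P-cong ≋-refl (negP-cong (≋-trans (≋-reflexive (cong constP (p[S]≡0 i k))) constP-0)))
           (+P-identityʳ (I[X] i k *P p)))

minimalPolynomial-factorisation : ∀ {n} (S : Mat ℤ (suc n)) d {m} →
  MonicOfDegree (suc d) m → Annihilates m S →
  (∀ p → Annihilates p S → DegreeBelow (suc d) p → p ≈P []) →
  ∃[ q ] (charPoly S ≋ q *P m × ∀ i k → D[X].adjugate (charMatrix S) i k ≋ q *P quotient S m i k)
minimalPolynomial-factorisation {n} S d {m} monic m[S]≡0 minimal
  with divideByMonic d monic (charPoly S)
... | q , r , χ≋qm+r , r<d = q , χ≋qm , adj≋qQ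
  where
  open ≋-Reasoning
  A = charMatrix S
  adjA = D[X].adjugate A
  qQ+Q : Mat Poly (suc n)
  qQ+Q i k = q *P quotient S m i k +P quotient S r i k
  W : Mat Poly (suc n)
  W i k = adjA i k +P negP (qQ+Q i k)
  A⊗W : ∀ i k → (A D[X].⊗ W) i k ≋ constM (evalM r S) i k
  A⊗W i k = begin
    (A D[X].⊗ W) i k
      ≈⟨ D[X].⊗-distribˡ-+ A adjA (λ a b → negP (qQ+Q a b)) i k ⟩
    (A D[X].⊗ adjA) i k +P (A D[X].⊗ (λ a b → negP (qQ+Q a b))) i k
      ≈⟨ +P-cong (charMatrix-⊗-adjugate S i k) (D[X].⊗-negʳ A qQ+Q i k) ⟩
    I[X] i k *P charPoly S +P negP ((A D[X].⊗ qQ+Q) i k)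
      ≈⟨ +P-cong (*P-congʳ (I[X] i k) χ≋qm+r)
                 (negP-cong (≋-trans (D[X].⊗-distribˡ-+ A (λ a b → q *P quotient S m a b) (quotient S r) i k)
                                     (+P-cong (D[X].⊗-scaleʳ A (quotient S m) q i k)
                                              (≋-refl {(A D[X].⊗ quotient S r) i k})))) ⟩
    I[X] i k *P (q *P m +P r) +P negP (q *P (A D[X].⊗ quotient S m) i k +P (A D[X].⊗ quotient S r) i k)
      ≈⟨ +P-cong (≋-refl {I[X] i k *P (q *P m +P r)})
                 (negP-cong (+P-cong (*P-congʳ q (charMatrix-⊗-quotient-annihilating S m m[S]≡0 i k))
                                            (charMatrix-⊗-quotient S r i k))) ⟩
    I[X] i k *P (q *P m +P r) +P negP (q *P (I[X] i k *P m) +P (I[X] i k *P r +P negP (constM (evalM r S) i k)))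
      ≈⟨ ℤ[X]-Identities.x*[y*z+w]-[y*[x*z]+[x*w-v]]≈v (I[X] i k) q m r (constM (evalM r S) i k) ⟩
    constM (evalM r S) i k ∎
  W≋0×r[S]≡0 = charMatrix-⊗-const⇒0 S W (evalM r S) A⊗W
  r≈0 : r ≈P []
  r≈0 = minimal r (proj₂ W≋0×r[S]≡0) r<d
  χ≋qm : charPoly S ≋ q *P m
  χ≋qm = ≋-trans χ≋qm+r
    (≋-trans (+P-cong (≋-refl {q *P m}) (≈P⇒≋ {r} {[]} r≈0)) (+P-identityʳ (q *P m)))
  adj≋qQ : ∀ i k → adjA i k ≋ q *P quotient S m i k
  adj≋qQ i k = begin
    adjA i k
      ≈⟨ ℤ[X]ₚ.x∙y⁻¹≈ε⇒x≈y (adjA i k) (qQ+Q i k) (proj₁ W≋0×r[S]≡0 i k) ⟩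
    q *P quotient S m i k +P quotient S r i k
      ≈⟨ +P-cong (≋-refl {q *P quotient S m i k}) (quotient-≈[] S r r≈0 i k) ⟩
    q *P quotient S m i k +P []
      ≈⟨ +P-identityʳ (q *P quotient S m i k) ⟩
    q *P quotient S m i k ∎

charMatrix-principalSub : ∀ {n} (S : Mat ℤ (suc n)) j a b →
  charMatrix (principalSub j S) a b ≋ charMatrix S (punchIn j a) (punchIn j b)
charMatrix-principalSub S j a b with a ≟ b | punchIn j a ≟ punchIn j b
... | yes _   | yes _    = ≋-refl
... | yes a≡b | no  ja≢jb = ⊥-elim (ja≢jb (cong (punchIn j) a≡b))
... | no  a≢b | yes ja≡jb = ⊥-elim (a≢b (Finₚ.punchIn-injective j a b ja≡jb))
... | no  _   | no  _    = ≋-refl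

charPoly-principalSub : ∀ {n} (S : Mat ℤ (suc n)) j →
  charPoly (principalSub j S) ≋ D[X].adjugate (charMatrix S) j j
charPoly-principalSub {n} S j = begin
  charPoly (principalSub j S)                  ≈⟨ charPoly≋det (principalSub j S) ⟩
  D[X].det n (charMatrix (principalSub j S))   ≈⟨ D[X].det-cong n (charMatrix-principalSub S j) ⟩
  D[X].det n (D[X].minor j j (charMatrix S))   ≈⟨ D[X].adjugate-diag (charMatrix S) j ⟨
  D[X].adjugate (charMatrix S) j j             ∎
  where open ≋-Reasoning

coeff-tabulate : ∀ {n} (f : Fin n → ℤ) t (t<n : t < n) → coeff (tabulate f) t ≡ f (fromℕ< t<n)
coeff-tabulate {suc n} f zero    _         = ≡.refl
coeff-tabulate {suc n} f (suc t) (s≤s t<n) = coeff-tabulate (f ∘ suc) t t<n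

fromDesc≡tabulate : ∀ d a → fromDesc d a ≡ tabulate (a ∘ opposite)
fromDesc≡tabulate d a = Listₚ.map-tabulate (λ k → k) (a ∘ opposite)

fromDesc′≡tabulate : ∀ d b → fromDesc' d b ≡ tabulate (b ∘ opposite)
fromDesc′≡tabulate d b = Listₚ.map-tabulate (λ k → k) (b ∘ opposite)

length-fromDesc : ∀ d a → length (fromDesc d a) ≡ suc d
length-fromDesc d a = ≡.trans (cong length (fromDesc≡tabulate d a)) (Listₚ.length-tabulate (a ∘ opposite))

coeff-fromDesc : ∀ d a (x : Fin (suc d)) → coeff (fromDesc d a) (d ∸ toℕ x) ≡ a x
coeff-fromDesc d a x = begin
  coeff (fromDesc d a) (d ∸ toℕ x)          ≡⟨ cong (λ p → coeff p (d ∸ toℕ x)) (fromDesc≡tabulate d a) ⟩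
  coeff (tabulate (a ∘ opposite)) (d ∸ toℕ x) ≡⟨ coeff-tabulate (a ∘ opposite) (d ∸ toℕ x) lt ⟩
  a (opposite (fromℕ< lt))                  ≡⟨ cong a (Finₚ.toℕ-injective toℕ-opposite) ⟩
  a x                                       ∎
  where
  open ≡.≡-Reasoning
  lt : d ∸ toℕ x < suc d
  lt = s≤s (ℕₚ.m∸n≤m d (toℕ x))
  toℕ-opposite : toℕ (opposite (fromℕ< lt)) ≡ toℕ x
  toℕ-opposite = ≡.trans (Finₚ.opposite-prop (fromℕ< lt))
    (≡.trans (cong (d ∸_) (Finₚ.toℕ-fromℕ< lt)) (ℕₚ.m∸[m∸n]≡n (ℕₚ.≤-pred (Finₚ.toℕ<n x))))

fromDesc-monic : ∀ d a → a zero ≡ 1ℤ → MonicOfDegree d (fromDesc d a)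
fromDesc-monic d a a₀≡1 = ≡.trans (coeff-fromDesc d a zero) a₀≡1 , λ k d<k →
  coeff-≥length (fromDesc d a) k (≡.subst (_≤ k) (≡.sym (length-fromDesc d a)) d<k)

descCoeffs : (d : ℕ) → Poly → Fin d → ℤ
descCoeffs d p i = coeff p (toℕ (opposite i))

fromDesc′-descCoeffs : ∀ d p → DegreeBelow d p → p ≈P fromDesc' d (descCoeffs d p)
fromDesc′-descCoeffs d p p<d k with k ℕ.<? d
... | yes k<d = ≡.sym (begin
  coeff (fromDesc' d b) k                      ≡⟨ cong (λ q → coeff q k) (fromDesc′≡tabulate d b) ⟩
  coeff (tabulate (b ∘ opposite)) k            ≡⟨ coeff-tabulate (b ∘ opposite) k k<d ⟩
  coeff p (toℕ (opposite (opposite (fromℕ< k<d)))) ≡⟨ cong (coeff p ∘ toℕ) (Finₚ.opposite-involutive (fromℕ< k<d)) ⟩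
  coeff p (toℕ (fromℕ< k<d))                   ≡⟨ cong (coeff p) (Finₚ.toℕ-fromℕ< k<d) ⟩
  coeff p k                                    ∎)
  where
  open ≡.≡-Reasoning
  b = descCoeffs d p
... | no  k≮d =
  ≡.trans (p<d k d≤k) (≡.sym (coeff-≥length (fromDesc' d b) k (≡.subst (_≤ k) (≡.sym length-b) d≤k)))
  where
  b = descCoeffs d p
  d≤k = ℕₚ.≮⇒≥ k≮d
  length-b : length (fromDesc' d b) ≡ d
  length-b = ≡.trans (cong length (fromDesc′≡tabulate d b)) (Listₚ.length-tabulate (b ∘ opposite))

drop-coeff : ∀ (p : Poly) k → k < length p → drop k p ≡ coeff p k ∷ drop (suc k) p
drop-coeff (c ∷ p) zero    _           = ≡.refl
drop-coeff (c ∷ p) (suc k) (s≤s k<len) = drop-coeff p k k<len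

drop-≥length : ∀ (p : Poly) k → length p ≤ k → drop k p ≡ []
drop-≥length []      k       _           = Listₚ.drop-[] k
drop-≥length (c ∷ p) (suc k) (s≤s len≤k) = drop-≥length p k len≤k

evalM-drop : ∀ {n} (S : Mat ℤ n) p k → k < length p →
  ∀ i l → evalM (drop k p) S i l ≡ coeff p k * identityM i l + (S Dℤ.⊗ evalM (drop (suc k) p) S) i l
evalM-drop S p k k<len i l =
  ≡.trans (cong (λ q → evalM q S i l) (drop-coeff p k k<len)) (evalM-∷ S (coeff p k) (drop (suc k) p) i l)

module HornerTail {n} (S : Mat ℤ n) (p : Poly) (D : ℕ) (length-p : length p ≡ suc D) where

  -- tail k = Σ_{i ≤ k} c_i S^{k−i}, where c_i = coeff p (D ∸ i) is the i-th coefficient from the top.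
  tail : ℕ → Mat ℤ n
  tail k = evalM (drop (D ∸ k) p) S

  tail-zero : ∀ i l → tail 0 i l ≡ coeff p D * identityM i l
  tail-zero i l = begin
    evalM (drop D p) S i l
      ≡⟨ evalM-drop S p D (≡.subst (D <_) (≡.sym length-p) ℕₚ.≤-refl) i l ⟩
    coeff p D * identityM i l + (S Dℤ.⊗ evalM (drop (suc D) p) S) i l
      ≡⟨ cong (_+_ (coeff p D * identityM i l)) (⊗-vanishingʳ S _ top≡0 i l) ⟩
    coeff p D * identityM i l + 0ℤ
      ≡⟨ ℤₚ.+-identityʳ _ ⟩
    coeff p D * identityM i l ∎
    where
    open ≡.≡-Reasoning
    top≡0 : ∀ a b → evalM (drop (suc D) p) S a b ≡ 0ℤ
    top≡0 a b = cong (λ q → evalM q S a b) (drop-≥length p (suc D) (ℕₚ.≤-reflexive length-p))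

  tail-suc : ∀ k → k < D → ∀ i l → tail (suc k) i l ≡ coeff p (D ∸ suc k) * identityM i l + (S Dℤ.⊗ tail k) i l
  tail-suc k k<D i l = ≡.trans (evalM-drop S p (D ∸ suc k) lt i l)
    (cong (λ t → coeff p (D ∸ suc k) * identityM i l + (S Dℤ.⊗ evalM (drop t p) S) i l)
          (≡.sym (ℕₚ.+-∸-assoc 1 k<D)))
    where
    lt : D ∸ suc k < length p
    lt = ≡.subst (D ∸ suc k <_) (≡.sym length-p) (s≤s (ℕₚ.m∸n≤m D (suc k)))

⊗-identityM : ∀ {n} (M : Mat ℤ n) i k → (M Dℤ.⊗ identityM) i k ≡ M i k
⊗-identityM {suc n} M i k = ≡.trans (Dℤ.sum-single (λ l → M i l * identityM l k) k vanish)
  (≡.trans (cong (M i k *_) (identityM-diag k)) (ℤₚ.*-identityʳ (M i k)))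
  where
  vanish : ∀ l → l ≢ k → M i l * identityM l k ≡ 0ℤ
  vanish l l≢k = ≡.trans (cong (M i l *_) (identityM-offDiag l≢k)) (ℤₚ.*-zeroʳ (M i l))

sum-ones : ∀ n → Dℤ.sum {n} (λ _ → 1ℤ) ≡ + n
sum-ones zero    = ≡.refl
sum-ones (suc n) = cong (_+_ 1ℤ) (sum-ones n)

seidel-square-diag : ∀ {n} (S : Mat ℤ (suc n)) → IsSeidel S → ∀ j → (S Dℤ.⊗ S) j j ≡ + n
seidel-square-diag {n} S (zero-diag , symmetric , ±1) j = begin
  Dℤ.sum (λ l → S j l * S l j)
    ≡⟨ Dℤ.sum-remove {i = j} (λ l → S j l * S l j) ⟩
  S j j * S j j + Dℤ.sum (λ l → S j (punchIn j l) * S (punchIn j l) j)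
    ≡⟨ cong₂ _+_ (cong (_* S j j) (zero-diag j))
                 (Dℤ.sum-cong-≋ {x = λ l → S j (punchIn j l) * S (punchIn j l) j} {y = λ _ → 1ℤ} off-diagonal) ⟩
  0ℤ + Dℤ.sum {n} (λ _ → 1ℤ)
    ≡⟨ ℤₚ.+-identityˡ (Dℤ.sum {n} (λ _ → 1ℤ)) ⟩
  Dℤ.sum {n} (λ _ → 1ℤ)
    ≡⟨ sum-ones n ⟩
  + n ∎
  where
  open ≡.≡-Reasoning
  square±1 : ∀ {x} → (x ≡ 1ℤ) ⊎ (x ≡ -1ℤ) → x * x ≡ 1ℤ
  square±1 (inj₁ ≡.refl) = ≡.refl
  square±1 (inj₂ ≡.refl) = ≡.refl
  off-diagonal : ∀ l → S j (punchIn j l) * S (punchIn j l) j ≡ 1ℤ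
  off-diagonal l = ≡.trans (cong (S j (punchIn j l) *_) (symmetric (punchIn j l) j))
                           (square±1 (±1 j (punchIn j l) (Finₚ.punchInᵢ≢i j l ∘ ≡.sym)))

module SeidelHornerTail {n} (S : Mat ℤ (suc n)) (seidel : IsSeidel S) (p : Poly) (D : ℕ)
                        (length-p : length p ≡ suc D) (monic : coeff p D ≡ 1ℤ) (j : Fin (suc n)) where

  open HornerTail S p D length-p
  open ≡.≡-Reasoning

  tail₀≡I : ∀ i l → tail 0 i l ≡ identityM i l
  tail₀≡I i l = ≡.trans (tail-zero i l) (≡.trans (cong (_* identityM i l) monic) (ℤₚ.*-identityˡ (identityM i l)))

  tail₁≡c₁I+S : 0 < D → ∀ i l → tail 1 i l ≡ coeff p (D ∸ 1) * identityM i l + S i l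
  tail₁≡c₁I+S 0<D i l = ≡.trans (tail-suc 0 0<D i l) (cong (_+_ (coeff p (D ∸ 1) * identityM i l)) (begin
    (S Dℤ.⊗ tail 0) i l       ≡⟨ Dℤ.sum-cong-≋ {x = λ a → S i a * tail 0 a l} {y = λ a → S i a * identityM a l}
                                   (λ a → cong (S i a *_) (tail₀≡I a l)) ⟩
    (S Dℤ.⊗ identityM) i l    ≡⟨ ⊗-identityM S i l ⟩
    S i l                     ∎))

  diag-c*I+S : ∀ c → c * identityM j j + S j j ≡ c
  diag-c*I+S c = begin
    c * identityM j j + S j j   ≡⟨ cong₂ (λ x y → c * x + y) (identityM-diag j) (proj₁ seidel j) ⟩
    c * 1ℤ + 0ℤ                 ≡⟨ ℤₚ.+-identityʳ (c * 1ℤ) ⟩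
    c * 1ℤ                      ≡⟨ ℤₚ.*-identityʳ c ⟩
    c                           ∎

  tail₀-diag : tail 0 j j ≡ 1ℤ
  tail₀-diag = ≡.trans (tail₀≡I j j) (identityM-diag j)

  tail₁-diag : 0 < D → tail 1 j j ≡ coeff p (D ∸ 1)
  tail₁-diag 0<D = ≡.trans (tail₁≡c₁I+S 0<D j j) (diag-c*I+S (coeff p (D ∸ 1)))

  tail₂-diag : 1 < D → tail 2 j j ≡ coeff p (D ∸ 2) + + n
  tail₂-diag 1<D = begin
    tail 2 j j
      ≡⟨ tail-suc 1 1<D j j ⟩
    c₂ * identityM j j + (S Dℤ.⊗ tail 1) j j
      ≡⟨ cong₂ _+_ (≡.trans (cong (c₂ *_) (identityM-diag j)) (ℤₚ.*-identityʳ c₂)) S⊗tail₁ ⟩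
    c₂ + + n ∎
    where
    c₁ = coeff p (D ∸ 1)
    c₂ = coeff p (D ∸ 2)
    S⊗tail₁ : (S Dℤ.⊗ tail 1) j j ≡ + n
    S⊗tail₁ = begin
      (S Dℤ.⊗ tail 1) j j
        ≡⟨ Dℤ.sum-cong-≋ {x = λ a → S j a * tail 1 a j} {y = λ a → S j a * (c₁ * identityM a j + S a j)}
                         (λ a → cong (S j a *_) (tail₁≡c₁I+S (ℕₚ.<-trans (s≤s z≤n) 1<D) a j)) ⟩
      (S Dℤ.⊗ (λ a b → c₁ * identityM a b + S a b)) j j
        ≡⟨ Dℤ.⊗-distribˡ-+ S (λ a b → c₁ * identityM a b) S j j ⟩
      (S Dℤ.⊗ (λ a b → c₁ * identityM a b)) j j + (S Dℤ.⊗ S) j j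
        ≡⟨ cong₂ _+_ (≡.trans (Dℤ.⊗-scaleʳ S identityM c₁ j j) (cong (c₁ *_) (⊗-identityM S j j)))
                     (seidel-square-diag S seidel j) ⟩
      c₁ * S j j + + n
        ≡⟨ cong (λ x → c₁ * x + + n) (proj₁ seidel j) ⟩
      c₁ * 0ℤ + + n
        ≡⟨ cong (_+ + n) (ℤₚ.*-zeroʳ c₁) ⟩
      + n ∎

seidel-quotient-diag : ∀ {n} (S : Mat ℤ (suc n)) → IsSeidel S → ∀ j d (a : Fin (suc d) → ℤ) → a zero ≡ 1ℤ →
  ∃[ b ] ((∀ (i : Fin d) → toℕ i ≡ 0 → b i ≡ 1ℤ) ×
          (∀ (i : Fin d) → toℕ i ≡ 1 → b i ≡ a (inject₁ i)) ×
          (∀ (i : Fin d) → toℕ i ≡ 2 → b i ≡ a (inject₁ i) + (+ (suc n) - 1ℤ)) ×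
          quotient S (fromDesc d a) j j ≈P fromDesc' d b)
seidel-quotient-diag {n} S seidel j d a a₀≡1 = descCoeffs d Qjj , b₀ , b₁ , b₂ , fromDesc′-descCoeffs d Qjj Qjj<d
  where
  m = fromDesc d a
  Qjj = quotient S m j j
  open SeidelHornerTail S seidel m d (length-fromDesc d a) (proj₁ (fromDesc-monic d a a₀≡1)) j
  open HornerTail S m d (length-fromDesc d a)
  Qjj<d : DegreeBelow d Qjj
  Qjj<d t d≤t = ≡.trans (quotient-coeff S m j j t)
    (cong (λ q → evalM q S j j)
          (drop-≥length m (suc t) (≡.subst (_≤ suc t) (≡.sym (length-fromDesc d a)) (s≤s d≤t))))
  b≡tail : ∀ i → descCoeffs d Qjj i ≡ tail (toℕ i) j j
  b≡tail i = ≡.trans (quotient-coeff S m j j _) (cong (λ k → evalM (drop k m) S j j) suc-opposite)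
    where
    suc-opposite : suc (toℕ (opposite i)) ≡ d ∸ toℕ i
    suc-opposite = ≡.trans (cong suc (Finₚ.opposite-prop i)) (≡.sym (ℕₚ.+-∸-assoc 1 (Finₚ.toℕ<n i)))
  coeff-m : ∀ (i : Fin d) k → toℕ i ≡ k → coeff m (d ∸ k) ≡ a (inject₁ i)
  coeff-m i k i≡k = ≡.trans (cong (λ t → coeff m (d ∸ t)) (≡.trans (≡.sym i≡k) (≡.sym (Finₚ.toℕ-inject₁ i))))
                            (coeff-fromDesc d a (inject₁ i))
  k<d : ∀ (i : Fin d) k → toℕ i ≡ k → k < d
  k<d i k i≡k = ≡.subst (_< d) i≡k (Finₚ.toℕ<n i)
  b₀ : ∀ i → toℕ i ≡ 0 → descCoeffs d Qjj i ≡ 1ℤ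
  b₀ i i≡0 = ≡.trans (b≡tail i) (≡.trans (cong (λ k → tail k j j) i≡0) tail₀-diag)
  b₁ : ∀ i → toℕ i ≡ 1 → descCoeffs d Qjj i ≡ a (inject₁ i)
  b₁ i i≡1 = ≡.trans (b≡tail i) (≡.trans (cong (λ k → tail k j j) i≡1)
    (≡.trans (tail₁-diag (ℕₚ.<-trans (s≤s z≤n) (k<d i 1 i≡1))) (coeff-m i 1 i≡1)))
  b₂ : ∀ i → toℕ i ≡ 2 → descCoeffs d Qjj i ≡ a (inject₁ i) + (+ (suc n) - 1ℤ)
  b₂ i i≡2 = ≡.trans (b≡tail i) (≡.trans (cong (λ k → tail k j j) i≡2)
    (≡.trans (tail₂-diag (ℕₚ.<-trans (s≤s (s≤s z≤n)) (k<d i 2 i≡2))) (cong (_+ + n) (coeff-m i 2 i≡2))))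

evalM-constant : ∀ {n} (S : Mat ℤ n) c i k → evalM (c ∷ []) S i k ≡ c * identityM i k
evalM-constant S c i k = ≡.trans (evalM-∷ S c [] i k)
  (≡.trans (cong (_+_ (c * identityM i k)) (⊗-vanishingʳ S (evalM [] S) (λ _ _ → ≡.refl) i k))
           (ℤₚ.+-identityʳ (c * identityM i k)))

constant-not-annihilating : ∀ {n} (S : Mat ℤ (suc n)) (a : Fin 1 → ℤ) → a zero ≡ 1ℤ →
  ¬ Annihilates (fromDesc 0 a) S
constant-not-annihilating {n} S a a₀≡1 a[S]≡0 = 1≢0 (begin
  1ℤ                                ≡⟨ ℤₚ.*-identityʳ 1ℤ ⟨
  1ℤ * 1ℤ                           ≡⟨ cong₂ _*_ a₀≡1 (identityM-diag {suc n} zero) ⟨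
  a zero * identityM {suc n} zero zero ≡⟨ evalM-constant S (a zero) zero zero ⟨
  evalM (fromDesc 0 a) S zero zero  ≡⟨ a[S]≡0 zero zero ⟩
  0ℤ                                ∎)
  where
  open ≡.≡-Reasoning
  1≢0 : 1ℤ ≢ 0ℤ
  1≢0 ()

lemma5p4 : (n : ℕ) (S : Mat ℤ (suc n)) (j : Fin (suc n)) →
    IsSeidel S →
    (d : ℕ) (a : Fin (suc d) → ℤ) → IsMinPoly S d a →
    ∃[ b ] ∃[ q ]
      ((∀ (i : Fin d) → toℕ i ≡ 0 → b i ≡ 1ℤ) ×
       (∀ (i : Fin d) → toℕ i ≡ 1 → b i ≡ a (inject₁ i)) ×
       (∀ (i : Fin d) → toℕ i ≡ 2 → b i ≡ a (inject₁ i) + (+ (suc n) - 1ℤ)) ×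
       (charPoly S ≈P q *P fromDesc d a) ×
       (charPoly (principalSub j S) ≈P q *P fromDesc' d b))
lemma5p4 n S j seidel zero    a (a₀≡1 , m[S]≡0 , _) = ⊥-elim (constant-not-annihilating S a a₀≡1 m[S]≡0)
lemma5p4 n S j seidel (suc d) a (a₀≡1 , m[S]≡0 , minimal) =
  let q , χS≋qm , adj≋qQ = minimalPolynomial-factorisation S d (fromDesc-monic (suc d) a a₀≡1) m[S]≡0 minimal
      b , b₀ , b₁ , b₂ , Qjj≈b = seidel-quotient-diag S seidel j (suc d) a a₀≡1
      χT≋qb = ≋-trans (charPoly-principalSub S j) (≋-trans (adj≋qQ j j) (*P-congʳ q (≈P⇒≋ Qjj≈b)))
  in b , q , b₀ , b₁ , b₂ , ≋⇒≈P χS≋qm , ≋⇒≈P χT≋qb
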